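{- In the setting of the context, define $\Omega_{1,j}=\omega_j$ for $1\le j\le n$ and recursively $\Omega_{i,j}=\wp(\Omega_{i-1,j})/\wp(\Omega_{i-1,i})$ for $2\le i\le j\le n$. Then $\wp(\Omega_{i-1,i})\ne0$ for $2\le i\le n$ (so the $\Omega_{i,j}$ are well defined), and for $1\le i\le j\le n$, $$v_0(\Omega_{i,j})=-p^{i-1}\sum_{k=i+1}^j m_k=p^{i-n}(u_i-u_j).$$
   Context: $K_0$ is complete with respect to a discrete valuation $v_0$ (normalized), with perfect residue field of characteristic $p$, valuation ring $\mathfrak{O}_0$, maximal ideal $\mathfrak{P}_0$; $\wp(x)=x^p-x$. $K_n/K_0$ is a totally ramified elementary abelian extension of degree $p^n$, $n>1$, with lower ramification numbers $b_1\le\dots\le b_n$ and upper ramification numbers $u_1\le\dots\le u_n$, where $p\nmid u_1$ and $u_i\equiv u_1\bmod p^{n-1}$. Elements $\omega_1=1,\omega_2,\dots,\omega_n\in K_0$ satisfy $0=v_0(\omega_1)\ge v_0(\omega_2)\ge\dots\ge v_0(\omega_n)$, and whenever $v_0(\omega_i)=\dots=v_0(\omega_j)$ with $i<j$, the images of $\omega_i,\dots,\omega_j$ in $\omega_i\mathfrak{O}_0/\omega_i\mathfrak{P}_0$ are linearly independent over $\mathbb{F}_p$. Put $m_i=v_0(\omega_{i-1})-v_0(\omega_i)$ for $i\ge2$; the data are related by $u_i=b_1+p^{n-1}\sum_{k=2}^i m_k$ (these $\omega_i$ arise from Artin–Schreier generators $x_i$ of the extension with $x_i^p-x_i=\omega_i^{p^{n-1}}\beta+\epsilon_i$,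 $v_0(\beta)=-b_1$, $v_0(\epsilon_i)>-u_i$). -}

module Defs where

open import Level using (Level; _⊔_; suc)
open import Algebra.Bundles using (CommutativeRing)
open import Data.Nat as ℕ using (ℕ; zero) renaming (suc to sucℕ)
open import Data.Integer as ℤ using (ℤ; +_)
open import Data.List using (List; map; upTo; foldr)
open import Data.Product using (Σ; _×_; ∃)
open import Relation.Nullary using (¬_)
open import Relation.Binary.PropositionalEquality using (_≡_)

-- Extended integers ℤ ∪ {∞}, the value group of a valuation (with v(0)=∞)

data ℤ∞ : Set where
  fin : ℤ → ℤ∞
  ∞   : ℤ∞

infix 4 _≤∞_
data _≤∞_ : ℤ∞ → ℤ∞ → Set where
  fin≤fin : ∀ {a b} → a ℤ.≤ b → fin a ≤∞ fin b
  _≤∞top  : ∀ x → x ≤∞ ∞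

infixl 6 _+∞_
_+∞_ : ℤ∞ → ℤ∞ → ℤ∞
fin a +∞ fin b = fin (a ℤ.+ b)
fin a +∞ ∞     = ∞
∞     +∞ y     = ∞

min∞ : ℤ∞ → ℤ∞ → ℤ∞
min∞ (fin a) (fin b) = fin (a ℤ.⊓ b)
min∞ (fin a) ∞       = fin a
min∞ ∞       y       = y

-- Sums over integer ranges: ∑[ a , b ] f = f a + f (a+1) + ... + f b
-- (empty, i.e. 0, when b < a)

rangeℕ : ℕ → ℕ → List ℕ
rangeℕ a b = map (a ℕ.+_) (upTo (sucℕ b ℕ.∸ a))

∑[_,_]_ : ℕ → ℕ → (ℕ → ℤ) → ℤ
∑[ a , b ] f = foldr ℤ._+_ (+ 0) (map f (rangeℕ a b))

-- Complete discretely valued fields with perfect residue field of char p.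
-- The field is a commutative ring (setoid equality) with a total inverse
-- function (0⁻¹ is a junk value, whose choice never matters below).

module RingOps {c ℓ : Level} (p : ℕ) (R : CommutativeRing c ℓ) where
  open CommutativeRing R

  infixr 8 _^_
  _^_ : Carrier → ℕ → Carrier
  x ^ zero   = 1#
  x ^ sucℕ k = x * (x ^ k)

  ι : ℕ → Carrier
  ι zero     = 0#
  ι (sucℕ k) = 1# + ι k

  ℘ : Carrier → Carrier
  ℘ x = x ^ p - x

  ∑ᴷ[_,_]_ : ℕ → ℕ → (ℕ → Carrier) → Carrier
  ∑ᴷ[ a , b ] f = foldr _+_ 0# (map f (rangeℕ a b))


record CDVF (p : ℕ) (c ℓ : Level) : Set (suc (c ⊔ ℓ)) where
  field
    cring : CommutativeRing c ℓ
  open CommutativeRing cring public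

  field
    _⁻¹       : Carrier → Carrier
    ⁻¹-cong   : ∀ {x y} → x ≈ y → x ⁻¹ ≈ y ⁻¹
    1≉0       : ¬ (1# ≈ 0#)
    inverseʳ  : ∀ x → ¬ (x ≈ 0#) → x * (x ⁻¹) ≈ 1#
    0⁻¹       : 0# ⁻¹ ≈ 0#

  infixl 7 _/_
  _/_ : Carrier → Carrier → Carrier
  x / y = x * (y ⁻¹)


  open RingOps p cring public

  field
    v        : Carrier → ℤ∞
    v-cong   : ∀ {x y} → x ≈ y → v x ≡ v y
    v-∞⇒0    : ∀ x → v x ≡ ∞ → x ≈ 0#
    v-0      : v 0# ≡ ∞
    v-mul    : ∀ x y → v (x * y) ≡ v x +∞ v y
    v-add    : ∀ x y → min∞ (v x) (v y) ≤∞ v (x + y)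
    v-normalized : ∃ λ π → v π ≡ fin (+ 1)

    complete : (s : ℕ → Carrier) →
      (∀ (N : ℤ) → ∃ λ M → ∀ k l → M ℕ.≤ k → M ℕ.≤ l → fin N ≤∞ v (s k - s l)) →
      ∃ λ L → ∀ (N : ℤ) → ∃ λ M → ∀ k → M ℕ.≤ k → fin N ≤∞ v (s k - L)

    -- residue field has characteristic p: p·1 lies in the maximal ideal
    residue-char : fin (+ 1) ≤∞ v (ι p)

    -- residue field is perfect: every residue class is a p-th power
    residue-perfect : ∀ x → fin (+ 0) ≤∞ v x →
      ∃ λ y → (fin (+ 0) ≤∞ v y) × (fin (+ 1) ≤∞ v (y ^ p - x))

-- The elements Ω_{i,j}:  Ω_{1,j} = ω_j,
--   Ω_{i,j} = ℘(Ω_{i-1,j}) / ℘(Ω_{i-1,i})   (i ≥ 2).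
-- (Indices are natural numbers; index 0 is unused, Ω_{0,j} := ω_j is junk.)

module _ {p : ℕ} {c ℓ : Level} (K : CDVF p c ℓ) where
  open CDVF K

  Ω : (ℕ → Carrier) → ℕ → ℕ → Carrier
  Ω ω zero            j = ω j
  Ω ω (sucℕ zero)     j = ω j
  Ω ω (sucℕ (sucℕ i)) j = ℘ (Ω ω (sucℕ i) j) / ℘ (Ω ω (sucℕ i) (sucℕ (sucℕ i)))

module Submission where

-- Row i of Ω is described by three facts: v(Ω_{i,j}) = p^{i-1}(e_j - e_i)
-- for j ≥ i, Ω_{i,i} = 1, and independence: on a block s < t on which e is constant, a combination
-- Σ a_k Ω_{i,k} with digits a_k < p whose valuation exceeds v(Ω_{i,s}) has all a_k = 0 (for i = 1 this
-- is the hypothesis on the ω_k).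
-- If e_j < e_i then v(Ω_{i,j}) < 0, hence v(℘ Ω_{i,j}) = p v(Ω_{i,j}).  If e_j = e_i then Ω_{i,j} is a
-- unit whose residue is not in 𝔽_p (independence against Ω_{i,i} = 1); as x^p - x has only the p roots
-- 0, …, p - 1 modulo 𝔓, ℘(Ω_{i,j}) is a unit too.  Dividing by ℘(Ω_{i,i+1}) gives row i + 1.
-- Independence passes to row i + 1 because ℘ commutes with 𝔽_p-combinations up to terms of higher
-- valuation (Frobenius): a small combination in row i + 1 makes ℘(Y) small for Y = Σ a_k Ω_{i,k}, so
-- either Y is small (e_s < e_i) or Y is congruent to a digit (e_s = e_i), both excluded in row i.
-- The closed forms then follow by telescoping Σ_{k=i+1}^{j} m_k = e_i - e_j.

open import Defs
open import Data.Nat using (ℕ; suc; _∸_; _≤_; _<_) renaming (_^_ to _^ℕ_)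
open import Data.Nat.Primality using (Prime; euclidsLemma; prime⇒nonTrivial)
open import Data.Integer using (ℤ; +_) renaming (-_ to -ℤ_; _+_ to _+ℤ_; _*_ to _*ℤ_; _-_ to _-ℤ_; _≤_ to _≤ℤ_; _<_ to _<ℤ_)
open import Data.Integer.Divisibility using () renaming (_∣_ to _∣ℤ_)
open import Data.Product using (_×_; Σ; _,_; proj₁; proj₂)
open import Relation.Nullary using (¬_; Dec; yes; no)
open import Relation.Binary.PropositionalEquality using (_≡_)

open import Algebra.Bundles using (CommutativeRing)
open import Data.Nat as ℕ using (zero; _!)
import Data.Nat.Properties as ℕ
open import Data.Nat.Combinatorics using (_C_; nCk≡n!/k![n-k]!; k![n∸k]!∣n!)
open import Data.Nat.DivMod using (m/n*n≡m)
open import Data.Nat.Divisibility using (_∣_; divides; ∣1⇒≡1; ∣⇒≤; m∣m*n)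
open import Data.Integer as ℤ using (-[1+_])
import Data.Integer.Properties as ℤ
open import Data.Sign as Sign using (Sign)
open import Data.Sum using (inj₁; inj₂)
open import Data.Empty using (⊥-elim)
open import Data.List using (List; []; _∷_; map; foldr; applyUpTo; upTo)
open import Data.List.Properties using (map-applyUpTo)
open import Data.List.Relation.Unary.All as All using (All; []; _∷_)
open import Function using (id; _∘_)
import Data.Integer.Tactic.RingSolver as ℤ-Solver
open import Relation.Binary.PropositionalEquality as ≡ using (module ≡-Reasoning)

prime>1 : ∀ {p} → Prime p → 1 < p
prime>1 {p} pp = ℕ.nonTrivial⇒n>1 p {{prime⇒nonTrivial pp}}

prime∤factorial : ∀ {p k} → Prime p → k < p → ¬ (p ∣ k !)
prime∤factorial {k = zero} pp _ p∣1 = ℕ.<-irrefl (≡.sym (∣1⇒≡1 p∣1)) (prime>1 pp)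
prime∤factorial {k = suc k} pp k<p p∣k! with euclidsLemma (suc k) (k !) pp p∣k!
... | inj₁ p∣1+k = ℕ.<⇒≱ k<p (∣⇒≤ p∣1+k)
... | inj₂ p∣k!′ = prime∤factorial pp (ℕ.<-trans (ℕ.n<1+n k) k<p) p∣k!′

binomial*factorials≡factorial : ∀ {n k} → k ≤ n → (n C k) ℕ.* (k ! ℕ.* (n ∸ k) !) ≡ n !
binomial*factorials≡factorial {n} {k} k≤n =
  ≡.trans (≡.cong (ℕ._* (k ! ℕ.* (n ∸ k) !)) (nCk≡n!/k![n-k]! k≤n)) (m/n*n≡m (k![n∸k]!∣n! k≤n))
  where instance _ = k ℕ.!* (n ∸ k) !≢0

prime∣binomial : ∀ {p j} → Prime p → 0 < j → j < p → p ∣ p C j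
prime∣binomial {suc q} {j} pp 0<j j<p
  with euclidsLemma (suc q C j) (j ! ℕ.* (suc q ∸ j) !) pp
         (≡.subst (suc q ∣_) (≡.sym (binomial*factorials≡factorial (ℕ.<⇒≤ j<p))) (m∣m*n (q !)))
... | inj₁ p∣pCj = p∣pCj
... | inj₂ p∣factorials with euclidsLemma (j !) ((suc q ∸ j) !) pp p∣factorials
...   | inj₁ p∣j! = ⊥-elim (prime∤factorial pp j<p p∣j!)
...   | inj₂ p∣[p∸j]! = ⊥-elim (prime∤factorial pp (ℕ.∸-monoʳ-< 0<j (ℕ.<⇒≤ j<p)) p∣[p∸j]!)

≤∞-trans : ∀ {a b d} → a ≤∞ b → b ≤∞ d → a ≤∞ d
≤∞-trans (fin≤fin a≤b) (fin≤fin b≤d) = fin≤fin (ℤ.≤-trans a≤b b≤d)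
≤∞-trans _             (_ ≤∞top)     = _ ≤∞top

≤-min∞ : ∀ {N a b} → fin N ≤∞ a → fin N ≤∞ b → fin N ≤∞ min∞ a b
≤-min∞ (fin≤fin N≤a) (fin≤fin N≤b) = fin≤fin (ℤ.⊓-glb N≤a N≤b)
≤-min∞ (fin≤fin N≤a) (_ ≤∞top)     = fin≤fin N≤a
≤-min∞ (_ ≤∞top)     N≤b           = N≤b

+∞-mono-≤ : ∀ {N M a b} → fin N ≤∞ a → fin M ≤∞ b → fin (N +ℤ M) ≤∞ a +∞ b
+∞-mono-≤ (fin≤fin N≤a) (fin≤fin M≤b) = fin≤fin (ℤ.+-mono-≤ N≤a M≤b)
+∞-mono-≤ (fin≤fin _)   (_ ≤∞top)     = _ ≤∞top
+∞-mono-≤ (_ ≤∞top)     _             = _ ≤∞top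

0+∞a≡a : ∀ a → fin (+ 0) +∞ a ≡ a
0+∞a≡a (fin a) = ≡.cong fin (ℤ.+-identityˡ a)
0+∞a≡a ∞       = ≡.refl

fin-injective : ∀ {a b} → fin a ≡ fin b → a ≡ b
fin-injective ≡.refl = ≡.refl

+1≤⇒< : ∀ {a b} → a +ℤ + 1 ≤ℤ b → a <ℤ b
+1≤⇒< {a} a+1≤b = ℤ.suc[i]≤j⇒i<j (≡.subst (_≤ℤ _) (ℤ.+-comm a (+ 1)) a+1≤b)

<⇒+1≤ : ∀ {a b} → a <ℤ b → a +ℤ + 1 ≤ℤ b
<⇒+1≤ {a} a<b = ≡.subst (_≤ℤ _) (ℤ.+-comm (+ 1) a) (ℤ.i<j⇒suc[i]≤j a<b)

i<0⇒[2+k]*i+1≤i : ∀ k {i} → i <ℤ + 0 → + suc (suc k) *ℤ i +ℤ + 1 ≤ℤ i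
i<0⇒[2+k]*i+1≤i k {i} i<0 = begin
  + suc (suc k) *ℤ i +ℤ + 1          ≡⟨ ≡.cong (_+ℤ + 1) (ℤ.*-distribʳ-+ i (+ 2) (+ k)) ⟩
  + 2 *ℤ i +ℤ + k *ℤ i +ℤ + 1        ≡⟨ rearrange i (+ k) ⟩
  i +ℤ (i +ℤ + 1) +ℤ + k *ℤ i        ≤⟨ ℤ.+-mono-≤ (ℤ.+-monoʳ-≤ i (<⇒+1≤ i<0))
                                                      (ℤ.*-monoˡ-≤-nonNeg (+ k) (ℤ.<⇒≤ i<0)) ⟩
  i +ℤ + 0 +ℤ + k *ℤ + 0             ≡⟨ ≡.cong₂ _+ℤ_ (ℤ.+-identityʳ i) (ℤ.*-zeroʳ (+ k)) ⟩
  i +ℤ + 0                           ≡⟨ ℤ.+-identityʳ i ⟩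
  i                                  ∎
  where
  open ℤ.≤-Reasoning
  rearrange : ∀ i K → + 2 *ℤ i +ℤ K *ℤ i +ℤ + 1 ≡ i +ℤ (i +ℤ + 1) +ℤ K *ℤ i
  rearrange = ℤ-Solver.solve-∀

[x-y]+1+y≡x+1 : ∀ x y → x -ℤ y +ℤ + 1 +ℤ y ≡ x +ℤ + 1
[x-y]+1+y≡x+1 = ℤ-Solver.solve-∀

[i+j]-j≡i : ∀ i j → (i +ℤ j) -ℤ j ≡ i
[i+j]-j≡i = ℤ-Solver.solve-∀

i≡i+i⇒i≡0 : ∀ {i} → i ≡ i +ℤ i → i ≡ + 0
i≡i+i⇒i≡0 {i} i≡i+i = begin
  i               ≡⟨ [i+j]-j≡i i i ⟨
  (i +ℤ i) -ℤ i   ≡⟨ ≡.cong (_-ℤ i) i≡i+i ⟨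
  i -ℤ i          ≡⟨ ℤ.+-inverseʳ i ⟩
  + 0             ∎
  where open ≡-Reasoning

range : ℕ → ℕ → List ℕ
range a zero    = []
range a (suc n) = a ∷ range (suc a) n

applyUpTo≡range : ∀ f a n → (∀ k → f k ≡ a ℕ.+ k) → applyUpTo f n ≡ range a n
applyUpTo≡range f a zero    f≡a+ = ≡.refl
applyUpTo≡range f a (suc n) f≡a+ = ≡.cong₂ _∷_ (≡.trans (f≡a+ 0) (ℕ.+-identityʳ a))
  (applyUpTo≡range (f ∘ suc) (suc a) n (λ k → ≡.trans (f≡a+ (suc k)) (ℕ.+-suc a k)))

rangeℕ≡range : ∀ a b → rangeℕ a b ≡ range a (suc b ∸ a)
rangeℕ≡range a b =
  ≡.trans (map-applyUpTo id (a ℕ.+_) (suc b ∸ a)) (applyUpTo≡range (a ℕ.+_) a _ λ _ → ≡.refl)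

rangeℕ-cons : ∀ {a b} → a ≤ b → rangeℕ a b ≡ a ∷ rangeℕ (suc a) b
rangeℕ-cons {a} {b} a≤b = begin
  rangeℕ a b                  ≡⟨ rangeℕ≡range a b ⟩
  range a (suc b ∸ a)         ≡⟨ ≡.cong (range a) (ℕ.+-∸-assoc 1 a≤b) ⟩
  a ∷ range (suc a) (b ∸ a)   ≡⟨ ≡.cong (a ∷_) (rangeℕ≡range (suc a) b) ⟨
  a ∷ rangeℕ (suc a) b        ∎
  where open ≡-Reasoning

rangeℕ-empty : ∀ {a b} → b < a → rangeℕ a b ≡ []
rangeℕ-empty {a} {b} b<a = ≡.cong (map (a ℕ.+_) ∘ upTo) (ℕ.m≤n⇒m∸n≡0 b<a)

All-range : ∀ {q} {P : ℕ → Set q} a n → (∀ k → a ≤ k → k < a ℕ.+ n → P k) → All P (range a n)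
All-range a zero    h = []
All-range a (suc n) h = h a ℕ.≤-refl (ℕ.m<m+n a (ℕ.s≤s ℕ.z≤n))
  ∷ All-range (suc a) n λ k a<k k<1+a+n →
      h k (ℕ.<⇒≤ a<k) (≡.subst (k <_) (≡.sym (ℕ.+-suc a n)) k<1+a+n)

All-rangeℕ : ∀ {q} {P : ℕ → Set q} a b → (∀ k → a ≤ k → k ≤ b → P k) → All P (rangeℕ a b)
All-rangeℕ {P = P} a b h with a ℕ.≤? b
... | no  a≰b = ≡.subst (All P) (≡.sym (rangeℕ-empty (ℕ.≰⇒> a≰b))) []
... | yes a≤b = ≡.subst (All P) (≡.sym (rangeℕ≡range a b))
  (All-range a (suc b ∸ a) λ k a≤k k<end →
    h k a≤k (ℕ.≤-pred (≡.subst (k <_) (ℕ.m+[n∸m]≡n (ℕ.m≤n⇒m≤1+n a≤b)) k<end)))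

module _ (e : ℕ → ℤ) where

  private
    m : ℕ → ℤ
    m k = e (k ∸ 1) -ℤ e k

  ∑-telescope : ∀ {a b} → a ≤ b → ∑[ suc a , b ] m ≡ e a -ℤ e b
  ∑-telescope {a} {b} a≤b = go (b ∸ a) a (ℕ.m∸n+n≡m a≤b)
    where
    go : ∀ d a → d ℕ.+ a ≡ b → ∑[ suc a , b ] m ≡ e a -ℤ e b
    go zero    a ≡.refl = ≡.trans (≡.cong (foldr _+ℤ_ (+ 0) ∘ map m) (rangeℕ-empty (ℕ.n<1+n a)))
                                   (≡.sym (ℤ.+-inverseʳ (e a)))
    go (suc d) a d+a≡b = begin
      ∑[ suc a , b ] m                              ≡⟨ ≡.cong (foldr _+ℤ_ (+ 0) ∘ map m) (rangeℕ-cons a<b) ⟩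
      m (suc a) +ℤ ∑[ suc (suc a) , b ] m
        ≡⟨ ≡.cong (m (suc a) +ℤ_) (go d (suc a) (≡.trans (ℕ.+-suc d a) d+a≡b)) ⟩
      (e a -ℤ e (suc a)) +ℤ (e (suc a) -ℤ e b)      ≡⟨ ℤ.+-minus-telescope (e a) (e (suc a)) (e b) ⟩
      e a -ℤ e b                                    ∎
      where
      open ≡-Reasoning
      a<b : a < b
      a<b = ≡.subst (a <_) d+a≡b (ℕ.s≤s (ℕ.m≤n+m a d))

  upper-ramification-difference : ∀ p n {i j} (b₁ : ℤ) (u : ℕ → ℤ) → 1 ≤ i → i ≤ j → j ≤ n →
    (∀ k → 1 ≤ k → k ≤ n → u k ≡ b₁ +ℤ + (p ^ℕ (n ∸ 1)) *ℤ ∑[ 2 , k ] m) →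
    + (p ^ℕ (n ∸ i)) *ℤ -ℤ (+ (p ^ℕ (i ∸ 1)) *ℤ ∑[ suc i , j ] m) ≡ u i -ℤ u j
  upper-ramification-difference p n {i} {j} b₁ u 1≤i i≤j j≤n u≡ = begin
    A *ℤ -ℤ (B *ℤ ∑[ suc i , j ] m)
      ≡⟨ ≡.cong (λ x → A *ℤ -ℤ (B *ℤ x)) (∑-telescope i≤j) ⟩
    A *ℤ -ℤ (B *ℤ (e i -ℤ e j))
      ≡⟨ rearrange A B b₁ (e 1) (e i) (e j) ⟩
    (b₁ +ℤ A *ℤ B *ℤ (e 1 -ℤ e i)) -ℤ (b₁ +ℤ A *ℤ B *ℤ (e 1 -ℤ e j))
      ≡⟨ ≡.cong₂ _-ℤ_ (u≡′ i≤n 1≤i) (u≡′ j≤n (ℕ.≤-trans 1≤i i≤j)) ⟨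
    u i -ℤ u j
      ∎
    where
    open ≡-Reasoning
    A = + (p ^ℕ (n ∸ i))
    B = + (p ^ℕ (i ∸ 1))
    i≤n = ℕ.≤-trans i≤j j≤n
    AB≡ : A *ℤ B ≡ + (p ^ℕ (n ∸ 1))
    AB≡ = ≡.trans (≡.sym (ℤ.pos-* (p ^ℕ (n ∸ i)) (p ^ℕ (i ∸ 1))))
      (≡.cong +_ (≡.trans (≡.sym (ℕ.^-distribˡ-+-* p (n ∸ i) (i ∸ 1)))
                          (≡.cong (p ^ℕ_) (exponents 1≤i i≤n))))
      where
      exponents : ∀ {i n} → 1 ≤ i → i ≤ n → (n ∸ i) ℕ.+ (i ∸ 1) ≡ n ∸ 1
      exponents {suc i} {suc n} _ (ℕ.s≤s i≤n) = ℕ.m∸n+n≡m i≤n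
    u≡′ : ∀ {k} → k ≤ n → 1 ≤ k → u k ≡ b₁ +ℤ A *ℤ B *ℤ (e 1 -ℤ e k)
    u≡′ {k} k≤n 1≤k =
      ≡.trans (u≡ k 1≤k k≤n) (≡.cong₂ (λ P x → b₁ +ℤ P *ℤ x) (≡.sym AB≡) (∑-telescope 1≤k))
    rearrange : ∀ A B b e₁ eᵢ eⱼ →
      A *ℤ -ℤ (B *ℤ (eᵢ -ℤ eⱼ)) ≡ (b +ℤ A *ℤ B *ℤ (e₁ -ℤ eᵢ)) -ℤ (b +ℤ A *ℤ B *ℤ (e₁ -ℤ eⱼ))
    rearrange = ℤ-Solver.solve-∀

prepend : ℕ → ℕ → (ℕ → ℕ) → ℕ → ℕ → ℕ
prepend i c a s k with s ℕ.≤? k | k ℕ.≟ i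
... | yes _ | _     = a k
... | no  _ | yes _ = c
... | no  _ | no  _ = 0

module _ {i c : ℕ} {a : ℕ → ℕ} {s : ℕ} where

  prepend-block : ∀ k → s ≤ k → prepend i c a s k ≡ a k
  prepend-block k s≤k with s ℕ.≤? k
  ... | yes _   = ≡.refl
  ... | no  s≰k = ⊥-elim (s≰k s≤k)

  prepend-head : i < s → prepend i c a s i ≡ c
  prepend-head i<s with s ℕ.≤? i | i ℕ.≟ i
  ... | yes s≤i | _      = ⊥-elim (ℕ.<⇒≱ i<s s≤i)
  ... | no  _   | yes _  = ≡.refl
  ... | no  _   | no i≢i = ⊥-elim (i≢i ≡.refl)

  prepend-gap : ∀ {k} → i < k → k < s → prepend i c a s k ≡ 0
  prepend-gap {k} i<k k<s with s ℕ.≤? k | k ℕ.≟ i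
  ... | yes s≤k | _       = ⊥-elim (ℕ.<⇒≱ k<s s≤k)
  ... | no  _   | yes k≡i = ⊥-elim (ℕ.<⇒≢ i<k (≡.sym k≡i))
  ... | no  _   | no  _   = ≡.refl

  prepend-digits : ∀ {p} → c < p → (∀ k → a k < p) → ∀ k → prepend i c a s k < p
  prepend-digits {p} c<p a<p k with s ℕ.≤? k | k ℕ.≟ i
  ... | yes _ | _     = a<p k
  ... | no  _ | yes _ = c<p
  ... | no  _ | no  _ = ℕ.≤-<-trans ℕ.z≤n c<p

module RingOpsProperties {c ℓ} (p : ℕ) (R : CommutativeRing c ℓ) where
  open CommutativeRing R
  open RingOps p R
  open import Algebra.Properties.Ring ring using (-‿involutive; -0#≈0#; -‿+-comm; -1*x≈-x)
  open import Relation.Binary.Reasoning.Setoid setoid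
  open import Algebra.Properties.CommutativeSemigroup +-commutativeSemigroup
    using (x∙yz≈y∙xz) renaming (interchange to +-interchange)
  open import Algebra.Properties.CommutativeSemigroup *-commutativeSemigroup
    using () renaming (interchange to *-interchange)
  open import Algebra.Solver.Ring.AlmostCommutativeRing using (fromCommutativeRing; _-Raw-AlmostCommutative⟶_)
  open import Data.Maybe using (Maybe; just; nothing)

  ι-+ : ∀ m n → ι (m ℕ.+ n) ≈ ι m + ι n
  ι-+ zero    n = sym (+-identityˡ _)
  ι-+ (suc m) n = trans (+-congˡ (ι-+ m n)) (sym (+-assoc _ _ _))

  ι-* : ∀ m n → ι (m ℕ.* n) ≈ ι m * ι n
  ι-* zero    n = sym (zeroˡ _)
  ι-* (suc m) n = begin
    ι (n ℕ.+ m ℕ.* n)      ≈⟨ trans (ι-+ n (m ℕ.* n)) (+-congˡ (ι-* m n)) ⟩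
    ι n + ι m * ι n        ≈⟨ +-congʳ (*-identityˡ _) ⟨
    1# * ι n + ι m * ι n   ≈⟨ distribʳ _ _ _ ⟨
    (1# + ι m) * ι n       ∎

  fromℤ : ℤ → Carrier
  fromℤ (+ n)    = ι n
  fromℤ -[1+ n ] = - ι (suc n)

  +-cancelˡ-- : ∀ a x y → (a + x) - (a + y) ≈ x - y
  +-cancelˡ-- a x y = begin
    (a + x) - (a + y)       ≈⟨ +-congˡ (-‿+-comm a y) ⟨
    (a + x) + (- a + - y)   ≈⟨ +-assoc a x _ ⟩
    a + (x + (- a + - y))   ≈⟨ +-congˡ (x∙yz≈y∙xz x (- a) (- y)) ⟩
    a + (- a + (x - y))     ≈⟨ +-assoc a (- a) _ ⟨
    (a - a) + (x - y)       ≈⟨ +-congʳ (-‿inverseʳ a) ⟩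
    0# + (x - y)            ≈⟨ +-identityˡ _ ⟩
    x - y                   ∎

  fromℤ-⊖ : ∀ m n → fromℤ (m ℤ.⊖ n) ≈ ι m - ι n
  fromℤ-⊖ zero    zero    = sym (-‿inverseʳ 0#)
  fromℤ-⊖ (suc m) zero    = sym (trans (+-congˡ -0#≈0#) (+-identityʳ _))
  fromℤ-⊖ zero    (suc n) = sym (+-identityˡ _)
  fromℤ-⊖ (suc m) (suc n) = begin
    fromℤ (suc m ℤ.⊖ suc n)   ≡⟨ ≡.cong fromℤ (ℤ.[1+m]⊖[1+n]≡m⊖n m n) ⟩
    fromℤ (m ℤ.⊖ n)           ≈⟨ fromℤ-⊖ m n ⟩
    ι m - ι n                 ≈⟨ +-cancelˡ-- 1# (ι m) (ι n) ⟨
    ι (suc m) - ι (suc n)     ∎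

  fromℤ-+ : ∀ i j → fromℤ (i ℤ.+ j) ≈ fromℤ i + fromℤ j
  fromℤ-+ (+ m)    (+ n)    = ι-+ m n
  fromℤ-+ (+ m)    -[1+ n ] = fromℤ-⊖ m (suc n)
  fromℤ-+ -[1+ m ] (+ n)    = trans (fromℤ-⊖ n (suc m)) (+-comm _ _)
  fromℤ-+ -[1+ m ] -[1+ n ] = begin
    - ι (suc (suc (m ℕ.+ n)))     ≡⟨ ≡.cong (λ k → - ι (suc k)) (ℕ.+-suc m n) ⟨
    - ι (suc m ℕ.+ suc n)         ≈⟨ -‿cong (ι-+ (suc m) (suc n)) ⟩
    - (ι (suc m) + ι (suc n))     ≈⟨ -‿+-comm _ _ ⟨
    - ι (suc m) + - ι (suc n)     ∎

  fromℤ-neg : ∀ i → fromℤ (ℤ.- i) ≈ - fromℤ i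
  fromℤ-neg (+ zero)  = sym -0#≈0#
  fromℤ-neg (+ suc n) = refl
  fromℤ-neg -[1+ n ]  = sym (-‿involutive _)

  fromSign : Sign → Carrier
  fromSign Sign.+ = 1#
  fromSign Sign.- = - 1#

  fromSign-* : ∀ s t → fromSign (s Sign.* t) ≈ fromSign s * fromSign t
  fromSign-* Sign.+ t      = sym (*-identityˡ _)
  fromSign-* Sign.- Sign.+ = sym (*-identityʳ _)
  fromSign-* Sign.- Sign.- = sym (trans (-1*x≈-x (- 1#)) (-‿involutive 1#))

  fromℤ-◃ : ∀ s n → fromℤ (s ℤ.◃ n) ≈ fromSign s * ι n
  fromℤ-◃ s       zero    = sym (zeroʳ _)
  fromℤ-◃ Sign.+ (suc n) = sym (*-identityˡ _)
  fromℤ-◃ Sign.- (suc n) = sym (-1*x≈-x _)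

  fromℤ-signAbs : ∀ i → fromℤ i ≈ fromSign (ℤ.sign i) * ι ℤ.∣ i ∣
  fromℤ-signAbs i = trans (reflexive (≡.cong fromℤ (≡.sym (ℤ.◃-inverse i)))) (fromℤ-◃ (ℤ.sign i) ℤ.∣ i ∣)

  fromℤ-* : ∀ i j → fromℤ (i ℤ.* j) ≈ fromℤ i * fromℤ j
  fromℤ-* i j = begin
    fromℤ (i ℤ.* j)                          ≈⟨ fromℤ-◃ (s Sign.* t) (m ℕ.* n) ⟩
    fromSign (s Sign.* t) * ι (m ℕ.* n)      ≈⟨ *-cong (fromSign-* s t) (ι-* m n) ⟩
    (fromSign s * fromSign t) * (ι m * ι n)  ≈⟨ *-interchange _ _ _ _ ⟩
    (fromSign s * ι m) * (fromSign t * ι n)  ≈⟨ *-cong (fromℤ-signAbs i) (fromℤ-signAbs j) ⟨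
    fromℤ i * fromℤ j                        ∎
    where s = ℤ.sign i ; t = ℤ.sign j ; m = ℤ.∣ i ∣ ; n = ℤ.∣ j ∣

  ℤ⟶R : ℤ.+-*-rawRing -Raw-AlmostCommutative⟶ fromCommutativeRing R
  ℤ⟶R = record
    { ⟦_⟧    = fromℤ
    ; +-homo = fromℤ-+
    ; *-homo = fromℤ-*
    ; -‿homo = fromℤ-neg
    ; 0-homo = refl
    ; 1-homo = +-identityʳ 1#
    }

  fromℤ-weaklyDec : ∀ i j → Maybe (fromℤ i ≈ fromℤ j)
  fromℤ-weaklyDec i j with i ℤ.≟ j
  ... | yes ≡.refl = just refl
  ... | no _       = nothing

  open import Algebra.Solver.Ring ℤ.+-*-rawRing (fromCommutativeRing R) ℤ⟶R fromℤ-weaklyDec public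

  -[x-y]≈y-x : ∀ x y → - (x - y) ≈ y - x
  -[x-y]≈y-x = solve 2 (λ x y → :- (x :- y) := y :- x) refl

  ^-1# : ∀ n → 1# ^ n ≈ 1#
  ^-1# zero    = refl
  ^-1# (suc n) = trans (*-identityˡ _) (^-1# n)

  ^-distrib-* : ∀ x y n → (x * y) ^ n ≈ x ^ n * y ^ n
  ^-distrib-* x y zero    = sym (*-identityˡ 1#)
  ^-distrib-* x y (suc n) = trans (*-congˡ (^-distrib-* x y n)) (*-interchange x y (x ^ n) (y ^ n))

  ∑ᴸ : (ℕ → Carrier) → List ℕ → Carrier
  ∑ᴸ f L = foldr _+_ 0# (map f L)

  ∑ᴸ-congᴬ : ∀ {f g} L → All (λ k → f k ≈ g k) L → ∑ᴸ f L ≈ ∑ᴸ g L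
  ∑ᴸ-congᴬ []      []         = refl
  ∑ᴸ-congᴬ (k ∷ L) (fk≈gk ∷ h) = +-cong fk≈gk (∑ᴸ-congᴬ L h)

  ∑ᴸ-cong : ∀ {f g} L → (∀ k → f k ≈ g k) → ∑ᴸ f L ≈ ∑ᴸ g L
  ∑ᴸ-cong L f≈g = ∑ᴸ-congᴬ L (All.universal f≈g L)

  ∑ᴸ-*ʳ : ∀ f d L → ∑ᴸ (λ k → f k * d) L ≈ ∑ᴸ f L * d
  ∑ᴸ-*ʳ f d []      = sym (zeroˡ d)
  ∑ᴸ-*ʳ f d (k ∷ L) = trans (+-congˡ (∑ᴸ-*ʳ f d L)) (sym (distribʳ d (f k) _))

  ∑ᴸ-- : ∀ f g L → ∑ᴸ (λ k → f k - g k) L ≈ ∑ᴸ f L - ∑ᴸ g L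
  ∑ᴸ-- f g []      = sym (-‿inverseʳ 0#)
  ∑ᴸ-- f g (k ∷ L) = trans (+-congˡ (∑ᴸ-- f g L))
    (trans (+-interchange (f k) (- g k) (∑ᴸ f L) (- ∑ᴸ g L)) (+-congˡ (-‿+-comm (g k) (∑ᴸ g L))))

  ∑ᴷ-cong : ∀ {a b f g} → (∀ k → a ≤ k → k ≤ b → f k ≈ g k) → ∑ᴷ[ a , b ] f ≈ ∑ᴷ[ a , b ] g
  ∑ᴷ-cong {a} {b} f≈g = ∑ᴸ-congᴬ (rangeℕ a b) (All-rangeℕ a b f≈g)

  ∑ᴷ-cons : ∀ {a b} f → a ≤ b → ∑ᴷ[ a , b ] f ≡ f a + ∑ᴷ[ suc a , b ] f
  ∑ᴷ-cons f a≤b = ≡.cong (∑ᴸ f) (rangeℕ-cons a≤b)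

  ∑ᴷ-singleton : ∀ f j → ∑ᴷ[ j , j ] f ≈ f j
  ∑ᴷ-singleton f j = begin
    ∑ᴷ[ j , j ] f               ≡⟨ ∑ᴷ-cons f ℕ.≤-refl ⟩
    f j + ∑ᴷ[ suc j , j ] f     ≡⟨ ≡.cong (λ L → f j + ∑ᴸ f L) (rangeℕ-empty (ℕ.n<1+n j)) ⟩
    f j + 0#                    ≈⟨ +-identityʳ (f j) ⟩
    f j                         ∎

  ∑ᴷ-drop-zeros : ∀ {a a′ b} f → a ≤ a′ → a′ ≤ suc b → (∀ k → a ≤ k → k < a′ → f k ≈ 0#) →
    ∑ᴷ[ a , b ] f ≈ ∑ᴷ[ a′ , b ] f
  ∑ᴷ-drop-zeros {a} {a′} {b} f a≤a′ a′≤1+b = go (a′ ∸ a) a (ℕ.m∸n+n≡m a≤a′)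
    where
    go : ∀ d a → d ℕ.+ a ≡ a′ → (∀ k → a ≤ k → k < a′ → f k ≈ 0#) →
      ∑ᴷ[ a , b ] f ≈ ∑ᴷ[ a′ , b ] f
    go zero    a ≡.refl _     = refl
    go (suc d) a d+a≡a′ zeros = begin
      ∑ᴷ[ a , b ] f             ≡⟨ ∑ᴷ-cons f (ℕ.≤-pred (ℕ.≤-trans a<a′ a′≤1+b)) ⟩
      f a + ∑ᴷ[ suc a , b ] f   ≈⟨ +-cong (zeros a ℕ.≤-refl a<a′)
                                     (go d (suc a) (≡.trans (ℕ.+-suc d a) d+a≡a′)
                                         (λ k a<k → zeros k (ℕ.<⇒≤ a<k))) ⟩
      0# + ∑ᴷ[ a′ , b ] f       ≈⟨ +-identityˡ _ ⟩
      ∑ᴷ[ a′ , b ] f            ∎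
      where
      a<a′ : a < a′
      a<a′ = ≡.subst (a <_) d+a≡a′ (ℕ.s≤s (ℕ.m≤n+m a d))

module Valuation {p c ℓ} (K : CDVF p c ℓ) where
  open CDVF K
  open RingOpsProperties p cring
  open import Algebra.Properties.Ring ring using (-1*x≈-x; -‿involutive)

  infix 4 _≤v_
  _≤v_ : ℤ → Carrier → Set
  N ≤v x = fin N ≤∞ v x

  v≡⇒≤v : ∀ {N x} → v x ≡ fin N → N ≤v x
  v≡⇒≤v vx≡N = ≡.subst (fin _ ≤∞_) (≡.sym vx≡N) (fin≤fin ℤ.≤-refl)

  ≤v-cong : ∀ {N x y} → x ≈ y → N ≤v x → N ≤v y
  ≤v-cong x≈y = ≡.subst (fin _ ≤∞_) (v-cong x≈y)

  ≤v-weaken : ∀ {M N x} → M ≤ℤ N → N ≤v x → M ≤v x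
  ≤v-weaken M≤N = ≤∞-trans (fin≤fin M≤N)

  ≤v-0# : ∀ {N} → N ≤v 0#
  ≤v-0# = ≡.subst (fin _ ≤∞_) (≡.sym v-0) (_ ≤∞top)

  ≤v-+ : ∀ {N x y} → N ≤v x → N ≤v y → N ≤v x + y
  ≤v-+ N≤x N≤y = ≤∞-trans (≤-min∞ N≤x N≤y) (v-add _ _)

  ≤v-* : ∀ {N M x y} → N ≤v x → M ≤v y → (N +ℤ M) ≤v x * y
  ≤v-* {x = x} {y} N≤x M≤y = ≡.subst (fin _ ≤∞_) (≡.sym (v-mul x y)) (+∞-mono-≤ N≤x M≤y)

  ≤v-dec : ∀ N x → Dec (N ≤v x)
  ≤v-dec N x with v x
  ... | ∞     = yes (_ ≤∞top)
  ... | fin a with N ℤ.≤? a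
  ...   | yes N≤a = yes (fin≤fin N≤a)
  ...   | no  N≰a = no λ { (fin≤fin N≤a) → N≰a N≤a }

  v-finite : ∀ x → ¬ (x ≈ 0#) → Σ ℤ λ a → v x ≡ fin a
  v-finite x x≉0 with v x in vx≡
  ... | fin a = a , ≡.refl
  ... | ∞     = ⊥-elim (x≉0 (v-∞⇒0 x vx≡))

  v-*-fin : ∀ {a b x y} → v x ≡ fin a → v y ≡ fin b → v (x * y) ≡ fin (a +ℤ b)
  v-*-fin {x = x} {y} vx≡a vy≡b = ≡.trans (v-mul x y) (≡.cong₂ _+∞_ vx≡a vy≡b)

  v-1# : v 1# ≡ fin (+ 0)
  v-1# with v-finite 1# 1≉0
  ... | a , v1≡a = ≡.trans v1≡a (≡.cong fin (i≡i+i⇒i≡0 (fin-injective (begin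
    fin a                ≡⟨ v1≡a ⟨
    v 1#                 ≡⟨ v-cong (*-identityˡ 1#) ⟨
    v (1# * 1#)          ≡⟨ v-*-fin v1≡a v1≡a ⟩
    fin (a +ℤ a)         ∎))))
    where open ≡-Reasoning

  v-‿1# : v (- 1#) ≡ fin (+ 0)
  v-‿1# = double≡0 (v (- 1#)) (begin
    v (- 1#) +∞ v (- 1#)   ≡⟨ v-mul (- 1#) (- 1#) ⟨
    v (- 1# * - 1#)        ≡⟨ v-cong (trans (-1*x≈-x (- 1#)) (-‿involutive 1#)) ⟩
    v 1#                   ≡⟨ v-1# ⟩
    fin (+ 0)              ∎)
    where
    open ≡-Reasoning
    double≡0 : ∀ a → a +∞ a ≡ fin (+ 0) → a ≡ fin (+ 0)
    double≡0 (fin (+ zero))   _ = ≡.refl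
    double≡0 (fin (+ suc n))  ()
    double≡0 (fin -[1+ n ])   ()
    double≡0 ∞                ()

  v-neg : ∀ x → v (- x) ≡ v x
  v-neg x = begin
    v (- x)                ≡⟨ v-cong (-1*x≈-x x) ⟨
    v (- 1# * x)           ≡⟨ v-mul (- 1#) x ⟩
    v (- 1#) +∞ v x        ≡⟨ ≡.cong (_+∞ v x) v-‿1# ⟩
    fin (+ 0) +∞ v x       ≡⟨ 0+∞a≡a (v x) ⟩
    v x                    ∎
    where open ≡-Reasoning

  ≤v-neg : ∀ {N x} → N ≤v x → N ≤v - x
  ≤v-neg {x = x} = ≡.subst (fin _ ≤∞_) (≡.sym (v-neg x))

  ≤v-- : ∀ {N x y} → N ≤v x → N ≤v y → N ≤v x - y
  ≤v-- N≤x N≤y = ≤v-+ N≤x (≤v-neg N≤y)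

  v≡⇒¬+1≤v : ∀ {a x} → v x ≡ fin a → ¬ ((a +ℤ + 1) ≤v x)
  v≡⇒¬+1≤v vx≡a a+1≤x with ≡.subst (fin _ ≤∞_) vx≡a a+1≤x
  ... | fin≤fin a+1≤a = ℤ.<-irrefl ≡.refl (+1≤⇒< a+1≤a)

  v-exact : ∀ {N x} → N ≤v x → ¬ ((N +ℤ + 1) ≤v x) → v x ≡ fin N
  v-exact {N} {x} N≤x N+1≰x with v x | N≤x
  ... | ∞     | _            = ⊥-elim (N+1≰x (_ ≤∞top))
  ... | fin a | fin≤fin N≤a with N ℤ.≟ a
  ...   | yes N≡a = ≡.cong fin (≡.sym N≡a)
  ...   | no  N≢a = ⊥-elim (N+1≰x (fin≤fin (<⇒+1≤ (ℤ.≤∧≢⇒< N≤a N≢a))))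

  v-+-dominant : ∀ {a x y} → v x ≡ fin a → (a +ℤ + 1) ≤v y → v (x + y) ≡ fin a
  v-+-dominant {a} {x} {y} vx≡a a+1≤y = v-exact
    (≤v-+ (v≡⇒≤v vx≡a) (≤v-weaken (ℤ.i≤i+j a (+ 1)) a+1≤y))
    (λ a+1≤x+y → v≡⇒¬+1≤v vx≡a (≤v-cong (x+y-y≈x x y) (≤v-- a+1≤x+y a+1≤y)))
    where
    x+y-y≈x : ∀ x y → (x + y) - y ≈ x
    x+y-y≈x = solve 2 (λ x y → (x :+ y) :- y := x) refl

  v-^ : ∀ {a x} k → v x ≡ fin a → v (x ^ k) ≡ fin (+ k *ℤ a)
  v-^ {a} zero    _    = ≡.trans v-1# (≡.cong fin (≡.sym (ℤ.*-zeroˡ a)))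
  v-^ {a} (suc k) vx≡a = ≡.trans (v-*-fin vx≡a (v-^ k vx≡a)) (≡.cong fin (≡.sym (ℤ.suc-* (+ k) a)))

  ≤v-^ : ∀ {N x} k → N ≤v x → (+ k *ℤ N) ≤v x ^ k
  ≤v-^ {N} zero    _   = ≡.subst (_≤v 1#) (≡.sym (ℤ.*-zeroˡ N)) (v≡⇒≤v v-1#)
  ≤v-^ {N} (suc k) N≤x = ≡.subst (_≤v _) (≡.sym (ℤ.suc-* (+ k) N)) (≤v-* N≤x (≤v-^ k N≤x))

  <v-^-cancel : ∀ {f x} k → (+ k *ℤ f +ℤ + 1) ≤v x ^ k → (f +ℤ + 1) ≤v x
  <v-^-cancel {f} {x} k kf<xᵏ with v x in vx≡
  ... | ∞     = _ ≤∞top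
  ... | fin a with ≡.subst (fin _ ≤∞_) (v-^ k vx≡) kf<xᵏ
  ...   | fin≤fin kf+1≤ka = fin≤fin (<⇒+1≤ (ℤ.*-cancelˡ-<-nonNeg (+ k) (+1≤⇒< kf+1≤ka)))

  /*≈ : ∀ {y} → ¬ (y ≈ 0#) → ∀ x → (x / y) * y ≈ x
  /*≈ {y} y≉0 x = begin
    (x * y ⁻¹) * y     ≈⟨ solve 3 (λ x y z → (x :* z) :* y := x :* (y :* z)) refl x y (y ⁻¹) ⟩
    x * (y * y ⁻¹)     ≈⟨ *-congˡ (inverseʳ y y≉0) ⟩
    x * 1#             ≈⟨ *-identityʳ x ⟩
    x                  ∎
    where open import Relation.Binary.Reasoning.Setoid setoid

  v-/ : ∀ {a b x y} → ¬ (y ≈ 0#) → v x ≡ fin a → v y ≡ fin b → v (x / y) ≡ fin (a -ℤ b)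
  v-/ {a} {b} {x} {y} y≉0 vx≡a vy≡b
    with v (x / y) | ≡.trans (≡.sym (v-mul (x / y) y)) (≡.trans (v-cong (/*≈ y≉0 x)) vx≡a)
  ... | ∞     | ()
  ... | fin q | q+vy≡a rewrite vy≡b =
    ≡.cong fin (≡.trans (≡.sym ([i+j]-j≡i q b)) (≡.cong (_-ℤ b) (fin-injective q+vy≡a)))

  0≤v1# : + 0 ≤v 1#
  0≤v1# = v≡⇒≤v v-1#

  ¬1≤v1# : ¬ (+ 1 ≤v 1#)
  ¬1≤v1# = v≡⇒¬+1≤v v-1#

  0≤vι : ∀ n → + 0 ≤v ι n
  0≤vι zero    = ≤v-0#
  0≤vι (suc n) = ≤v-+ 0≤v1# (0≤vι n)

  1≤vι-* : ∀ k {m} → + 1 ≤v ι m → + 1 ≤v ι (k ℕ.* m)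
  1≤vι-* k 1≤m = ≤v-cong (sym (ι-* k _)) (≤v-* (0≤vι k) 1≤m)

  1≤v-cancel-unit : ∀ {u w} → + 0 ≤v u → ¬ (+ 1 ≤v u) → + 0 ≤v w → + 1 ≤v u * w → + 1 ≤v w
  1≤v-cancel-unit {u} {w} 0≤u 1≰u 0≤w 1≤uw = ≡.subst (fin (+ 1) ≤∞_) (0+∞a≡a (v w))
    (≡.subst (fin (+ 1) ≤∞_) (≡.trans (v-mul u w) (≡.cong (_+∞ v w) (v-exact 0≤u 1≰u))) 1≤uw)

  ≤v-∑ᴸ : ∀ {N f} L → All (λ k → N ≤v f k) L → N ≤v ∑ᴸ f L
  ≤v-∑ᴸ []      []           = ≤v-0#
  ≤v-∑ᴸ (k ∷ L) (N≤fk ∷ N≤f) = ≤v-+ N≤fk (≤v-∑ᴸ L N≤f)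

  ≤v-∑ᴷ : ∀ {N f a b} → (∀ k → a ≤ k → k ≤ b → N ≤v f k) → N ≤v ∑ᴷ[ a , b ] f
  ≤v-∑ᴷ {a = a} {b} N≤f = ≤v-∑ᴸ (rangeℕ a b) (All-rangeℕ a b N≤f)

  1≤vι-multiple : ∀ {n} → p ∣ n → + 1 ≤v ι n
  1≤vι-multiple (divides q ≡.refl) = 1≤vι-* q residue-char

module Polynomials {p c ℓ} (K : CDVF p c ℓ) where
  open CDVF K
  open RingOpsProperties p cring
  open Valuation K
  open import Relation.Binary.Reasoning.Setoid setoid

  Poly : ℕ → Set c
  Poly zero    = Carrier
  Poly (suc n) = Carrier × Poly n

  eval : ∀ n → Poly n → Carrier → Carrier
  eval zero    a       x = a
  eval (suc n) (a , g) x = a + x * eval n g x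

  lead : ∀ n → Poly n → Carrier
  lead zero    a       = a
  lead (suc n) (a , g) = lead n g

  Integral : ∀ n → Poly n → Set
  Integral zero    a       = + 0 ≤v a
  Integral (suc n) (a , g) = (+ 0 ≤v a) × Integral n g

  monomial : ∀ n → Poly n
  monomial zero    = 1#
  monomial (suc n) = 0# , monomial n

  addScaled : ∀ n → Carrier → Poly n → Poly (suc n) → Poly (suc n)
  addScaled zero    r c       (a , g) = a + r * c , g
  addScaled (suc n) r (c , h) (a , g) = a + r * c , addScaled n r h g

  quotient : ∀ n → Carrier → Poly (suc n) → Poly n
  quotient zero    r (a , g) = g
  quotient (suc n) r (a , g) = addScaled n r (quotient n r g) g

  lead-monomial : ∀ n → lead n (monomial n) ≡ 1#
  lead-monomial zero    = ≡.refl
  lead-monomial (suc n) = lead-monomial n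

  Integral-monomial : ∀ n → Integral n (monomial n)
  Integral-monomial zero    = 0≤v1#
  Integral-monomial (suc n) = ≤v-0# , Integral-monomial n

  eval-monomial : ∀ n x → eval n (monomial n) x ≈ x ^ n
  eval-monomial zero    x = refl
  eval-monomial (suc n) x = trans (+-identityˡ _) (*-congˡ (eval-monomial n x))

  eval-addScaled : ∀ n r h g x → eval (suc n) (addScaled n r h g) x ≈ r * eval n h x + eval (suc n) g x
  eval-addScaled zero    r c       (a , g) x =
    solve 5 (λ a r c x g → a :+ r :* c :+ x :* g := r :* c :+ (a :+ x :* g)) refl a r c x g
  eval-addScaled (suc n) r (c , h) (a , g) x = trans (+-congˡ (*-congˡ (eval-addScaled n r h g x)))
    (solve 6 (λ a r c x H G → a :+ r :* c :+ x :* (r :* H :+ G) := r :* (c :+ x :* H) :+ (a :+ x :* G)) refl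
      a r c x (eval n h x) (eval (suc n) g x))

  factor-theorem : ∀ n r f x → eval (suc n) f x - eval (suc n) f r ≈ (x - r) * eval n (quotient n r f) x
  factor-theorem zero    r (a , l) x = solve 4 (λ a l x r → (a :+ x :* l) :- (a :+ r :* l) := (x :- r) :* l) refl a l x r
  factor-theorem (suc n) r (a , g) x = begin
    (a + x * G) - (a + r * Gr)                   ≈⟨ +-congˡ (-‿cong (+-congˡ (*-congˡ Gr≈))) ⟩
    (a + x * G) - (a + r * (G - (x - r) * Q))
      ≈⟨ solve 5 (λ a x r G Q → (a :+ x :* G) :- (a :+ r :* (G :- (x :- r) :* Q)) := (x :- r) :* (r :* Q :+ G))
                 refl a x r G Q ⟩
    (x - r) * (r * Q + G)                        ≈⟨ *-congˡ (eval-addScaled n r (quotient n r g) g x) ⟨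
    (x - r) * eval (suc n) (quotient (suc n) r (a , g)) x ∎
    where
    G  = eval (suc n) g x
    Gr = eval (suc n) g r
    Q  = eval n (quotient n r g) x
    Gr≈ : Gr ≈ G - (x - r) * Q
    Gr≈ = trans (solve 2 (λ G Gr → Gr := G :- (G :- Gr)) refl G Gr) (+-congˡ (-‿cong (factor-theorem n r g x)))

  lead-addScaled : ∀ n r h g → lead (suc n) (addScaled n r h g) ≡ lead (suc n) g
  lead-addScaled zero    r c       (a , g) = ≡.refl
  lead-addScaled (suc n) r (c , h) (a , g) = lead-addScaled n r h g

  lead-quotient : ∀ n r f → lead n (quotient n r f) ≡ lead (suc n) f
  lead-quotient zero    r (a , l) = ≡.refl
  lead-quotient (suc n) r (a , g) = lead-addScaled n r (quotient n r g) g

  Integral-addScaled : ∀ n {r} h g → + 0 ≤v r → Integral n h → Integral (suc n) g →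
    Integral (suc n) (addScaled n r h g)
  Integral-addScaled zero    c       (a , g) 0≤r 0≤c       (0≤a , 0≤g)  = ≤v-+ 0≤a (≤v-* 0≤r 0≤c) , 0≤g
  Integral-addScaled (suc n) (c , h) (a , g) 0≤r (0≤c , 0≤h) (0≤a , 0≤g) =
    ≤v-+ 0≤a (≤v-* 0≤r 0≤c) , Integral-addScaled n h g 0≤r 0≤h 0≤g

  Integral-quotient : ∀ n {r} f → + 0 ≤v r → Integral (suc n) f → Integral n (quotient n r f)
  Integral-quotient zero    (a , l) 0≤r (_ , 0≤l) = 0≤l
  Integral-quotient (suc n) (a , g) 0≤r (_ , 0≤g) =
    Integral-addScaled n (quotient n _ g) g 0≤r (Integral-quotient n g 0≤r 0≤g) 0≤g

  Integral-eval : ∀ n f {x} → Integral n f → + 0 ≤v x → + 0 ≤v eval n f x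
  Integral-eval zero    a       0≤a         0≤x = 0≤a
  Integral-eval (suc n) (a , g) (0≤a , 0≤g) 0≤x = ≤v-+ 0≤a (≤v-* 0≤x (Integral-eval n g 0≤g 0≤x))

  no-incongruent-roots-beyond-degree : ∀ n (f : Poly n) (ρ : ℕ → Carrier) →
    Integral n f → ¬ (+ 1 ≤v lead n f) →
    (∀ i → i ≤ n → + 0 ≤v ρ i) → (∀ i j → i < j → j ≤ n → ¬ (+ 1 ≤v ρ j - ρ i)) →
    ¬ (∀ i → i ≤ n → + 1 ≤v eval n f (ρ i))
  no-incongruent-roots-beyond-degree zero    f ρ _     unit _         _           roots = unit (roots 0 ℕ.z≤n)
  no-incongruent-roots-beyond-degree (suc n) f ρ 0≤f unit 0≤ρ incongruent roots =
    no-incongruent-roots-beyond-degree n (quotient n (ρ 0) f) (ρ ∘ suc)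
      (Integral-quotient n f (0≤ρ 0 ℕ.z≤n) 0≤f)
      (≡.subst (λ l → ¬ (+ 1 ≤v l)) (≡.sym (lead-quotient n (ρ 0) f)) unit)
      (λ i i≤n → 0≤ρ (suc i) (ℕ.s≤s i≤n))
      (λ i j i<j j≤n → incongruent (suc i) (suc j) (ℕ.s≤s i<j) (ℕ.s≤s j≤n))
      (λ i i≤n → 1≤v-cancel-unit (≤v-- (0≤ρ (suc i) (ℕ.s≤s i≤n)) (0≤ρ 0 ℕ.z≤n))
        (incongruent 0 (suc i) (ℕ.s≤s ℕ.z≤n) (ℕ.s≤s i≤n))
        (Integral-eval n _ (Integral-quotient n f (0≤ρ 0 ℕ.z≤n) 0≤f) (0≤ρ (suc i) (ℕ.s≤s i≤n)))
        (≤v-cong (factor-theorem n (ρ 0) f (ρ (suc i))) (≤v-- (roots (suc i) (ℕ.s≤s i≤n)) (roots 0 ℕ.z≤n))))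

-- The prime is taken in the form 2 + r so that x ^ p and Fin p unfold by pattern matching.
module ResidueField {r c ℓ} (pp : Prime (suc (suc r))) (K : CDVF (suc (suc r)) c ℓ) where
  open CDVF K

  p : ℕ
  p = suc (suc r)

  open RingOpsProperties p cring
  open Valuation K
  open Polynomials K
  open import Relation.Binary.Reasoning.Setoid setoid
  open import Data.Nat.Coprimality using (prime⇒coprime; coprime-Bézout)
  open import Data.Nat.GCD using (module Bézout)
  open import Algebra.Properties.Semiring.Exp semiring using () renaming (_^_ to _^′_)
  open import Algebra.Properties.Semiring.Mult semiring using () renaming (_×_ to _×′_)
  open import Algebra.Properties.Semiring.Sum semiring using (sum; sum-init-last)
  import Algebra.Properties.CommutativeSemiring.Binomial commutativeSemiring as Binomial
  open import Data.Fin as Fin using (Fin; toℕ; inject₁; fromℕ)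
  import Data.Fin.Properties as Fin
  open import Data.Nat.Combinatorics using (nCn≡1)

  v-ι-unit : ∀ {n} → 0 < n → n < p → v (ι n) ≡ fin (+ 0)
  v-ι-unit {n} 0<n n<p = v-exact (0≤vι n) (λ 1≤n → ¬1≤v1# (bézout 1≤n))
    where
    instance _ = ℕ.>-nonZero 0<n
    1+a≈b⇒1≈b-a : ∀ {a b} → 1# + a ≈ b → 1# ≈ b - a
    1+a≈b⇒1≈b-a {a} {b} 1+a≈b = trans (solve 2 (λ a o → o := (o :+ a) :- a) refl a 1#) (+-congʳ 1+a≈b)
    bézout : + 1 ≤v ι n → + 1 ≤v 1#
    bézout 1≤n with coprime-Bézout (prime⇒coprime pp n<p)
    ... | Bézout.+- x y 1+yn≡xp = ≤v-cong (sym (1+a≈b⇒1≈b-a (reflexive (≡.cong ι 1+yn≡xp))))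
                                    (≤v-- (1≤vι-* x residue-char) (1≤vι-* y 1≤n))
    ... | Bézout.-+ x y 1+xp≡yn = ≤v-cong (sym (1+a≈b⇒1≈b-a (reflexive (≡.cong ι 1+xp≡yn))))
                                    (≤v-- (1≤vι-* y 1≤n) (1≤vι-* x residue-char))

  ^≈^′ : ∀ x n → x ^ n ≈ x ^′ n
  ^≈^′ x zero    = refl
  ^≈^′ x (suc n) = *-congˡ (^≈^′ x n)

  ×′≈ι* : ∀ n z → n ×′ z ≈ ι n * z
  ×′≈ι* zero    z = sym (zeroˡ z)
  ×′≈ι* (suc n) z = trans (+-cong (sym (*-identityˡ z)) (×′≈ι* n z)) (sym (distribʳ _ _ _))

  ≤v-sum : ∀ {N} n (f : Fin n → Carrier) → (∀ i → N ≤v f i) → N ≤v sum f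
  ≤v-sum zero    f N≤f = ≤v-0#
  ≤v-sum (suc n) f N≤f = ≤v-+ (N≤f Fin.zero) (≤v-sum n (λ i → f (Fin.suc i)) (λ i → N≤f (Fin.suc i)))

  [x+y]ᵖ-xᵖ-yᵖ≈inner-terms : ∀ x y →
    (x + y) ^ p - x ^ p - y ^ p ≈ sum (λ (k : Fin (suc r)) → Binomial.binomialTerm x y p (Fin.suc (inject₁ k)))
  [x+y]ᵖ-xᵖ-yᵖ≈inner-terms x y = begin
    (x + y) ^ p - x ^ p - y ^ p             ≈⟨ +-congʳ (+-congʳ expansion) ⟩
    (y ^ p + (inner + x ^ p)) - x ^ p - y ^ p ≈⟨ solve 3 (λ a b c → a :+ (b :+ c) :- c :- a := b)
                                                        refl (y ^ p) inner (x ^ p) ⟩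
    inner                                    ∎
    where
    T = Binomial.binomialTerm x y p
    inner = sum (λ k → T (Fin.suc (inject₁ k)))
    first : T Fin.zero ≈ y ^ p
    first = begin
      (p C 0) ×′ (x ^′ 0 * y ^′ p)   ≡⟨⟩
      1 ×′ (1# * y ^′ p)             ≈⟨ trans (+-identityʳ _) (*-identityˡ _) ⟩
      y ^′ p                         ≈⟨ ^≈^′ y p ⟨
      y ^ p                          ∎
    last : T (Fin.suc (fromℕ (suc r))) ≈ x ^ p
    last = begin
      T (Fin.suc (fromℕ (suc r)))
        ≡⟨ ≡.cong (λ k → (p C k) ×′ (x ^′ k * y ^′ (p ∸ k))) (≡.cong suc (Fin.toℕ-fromℕ (suc r))) ⟩
      (p C p) ×′ (x ^′ p * y ^′ (p ∸ p))
        ≡⟨ ≡.cong₂ (λ c k → c ×′ (x ^′ p * y ^′ k)) (nCn≡1 p) (ℕ.n∸n≡0 p) ⟩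
      1 ×′ (x ^′ p * 1#)             ≈⟨ trans (+-identityʳ _) (*-identityʳ _) ⟩
      x ^′ p                         ≈⟨ ^≈^′ x p ⟨
      x ^ p                          ∎
    expansion : (x + y) ^ p ≈ y ^ p + (inner + x ^ p)
    expansion = begin
      (x + y) ^ p                        ≈⟨ ^≈^′ (x + y) p ⟩
      (x + y) ^′ p                       ≈⟨ Binomial.theorem p x y ⟩
      T Fin.zero + sum (λ k → T (Fin.suc k)) ≈⟨ +-cong first (sum-init-last (λ k → T (Fin.suc k))) ⟩
      y ^ p + (inner + T (Fin.suc (fromℕ (suc r)))) ≈⟨ +-congˡ (+-congˡ last) ⟩
      y ^ p + (inner + x ^ p)            ∎

  ≤v-inner-binomialTerm : ∀ {m x y} j → m ≤v x → m ≤v y → 0 < j → j < p →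
    (+ p *ℤ m +ℤ + 1) ≤v (p C j) ×′ (x ^′ j * y ^′ (p ∸ j))
  ≤v-inner-binomialTerm {m} {x} {y} j m≤x m≤y 0<j j<p =
    ≤v-cong (trans (*-congˡ (*-cong (^≈^′ x j) (^≈^′ y (p ∸ j)))) (sym (×′≈ι* (p C j) _)))
      (≡.subst (_≤v _) 1+[jm+[p∸j]m]≡pm+1
        (≤v-* (1≤vι-multiple (prime∣binomial pp 0<j j<p)) (≤v-* (≤v-^ j m≤x) (≤v-^ (p ∸ j) m≤y))))
    where
    1+[jm+[p∸j]m]≡pm+1 : + 1 +ℤ (+ j *ℤ m +ℤ + (p ∸ j) *ℤ m) ≡ + p *ℤ m +ℤ + 1
    1+[jm+[p∸j]m]≡pm+1 = ≡.trans (ℤ.+-comm (+ 1) (+ j *ℤ m +ℤ + (p ∸ j) *ℤ m)) (≡.cong (_+ℤ + 1)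
      (≡.trans (≡.sym (ℤ.*-distribʳ-+ m (+ j) (+ (p ∸ j))))
               (≡.cong (λ k → + k *ℤ m) (ℕ.m+[n∸m]≡n (ℕ.<⇒≤ j<p)))))

  ≤v-[x+y]ᵖ-xᵖ-yᵖ : ∀ {m x y} → m ≤v x → m ≤v y → (+ p *ℤ m +ℤ + 1) ≤v (x + y) ^ p - x ^ p - y ^ p
  ≤v-[x+y]ᵖ-xᵖ-yᵖ {x = x} {y} m≤x m≤y = ≤v-cong (sym ([x+y]ᵖ-xᵖ-yᵖ≈inner-terms x y))
    (≤v-sum (suc r) _ λ k → ≤v-inner-binomialTerm (suc (toℕ (inject₁ k))) m≤x m≤y (ℕ.s≤s ℕ.z≤n)
      (ℕ.s≤s (≡.subst (_< suc r) (≡.sym (Fin.toℕ-inject₁ k)) (Fin.toℕ<n k))))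

  1≤v-[x+y]ᵖ-xᵖ-yᵖ : ∀ {x y} → + 0 ≤v x → + 0 ≤v y → + 1 ≤v (x + y) ^ p - x ^ p - y ^ p
  1≤v-[x+y]ᵖ-xᵖ-yᵖ {x} {y} 0≤x 0≤y = ≡.subst (_≤v (x + y) ^ p - x ^ p - y ^ p)
    (≡.cong (_+ℤ + 1) (ℤ.*-zeroʳ (+ p))) (≤v-[x+y]ᵖ-xᵖ-yᵖ 0≤x 0≤y)

  ≤v-ιᵖ-ι : ∀ a → + 1 ≤v ι a ^ p - ι a
  ≤v-ιᵖ-ι zero    = ≤v-cong (sym (trans (+-congʳ (zeroˡ _)) (-‿inverseʳ 0#))) ≤v-0#
  ≤v-ιᵖ-ι (suc a) =
    ≤v-cong (sym split) (≤v-+ (≤v-+ (1≤v-[x+y]ᵖ-xᵖ-yᵖ 0≤v1# (0≤vι a)) 1ᵖ-1) (≤v-ιᵖ-ι a))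
    where
    1ᵖ-1 : + 1 ≤v 1# ^ p - 1#
    1ᵖ-1 = ≤v-cong (sym (trans (+-congʳ (^-1# p)) (-‿inverseʳ 1#))) ≤v-0#
    split : (1# + ι a) ^ p - (1# + ι a) ≈ ((1# + ι a) ^ p - 1# ^ p - ι a ^ p) + (1# ^ p - 1#) + (ι a ^ p - ι a)
    split = solve 5 (λ A B C D E → A :- (E :+ D) := (A :- B :- C) :+ (B :- E) :+ (C :- D)) refl
      ((1# + ι a) ^ p) (1# ^ p) (ι a ^ p) (ι a) 1#

  ≤v-[∑ᴸ]ᵖ-∑ᴸ : ∀ {m} h g L → All (λ k → (m ≤v h k) × ((+ p *ℤ m +ℤ + 1) ≤v h k ^ p - g k)) L →
    (+ p *ℤ m +ℤ + 1) ≤v (∑ᴸ h L) ^ p - ∑ᴸ g L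
  ≤v-[∑ᴸ]ᵖ-∑ᴸ h g []      [] = ≤v-cong (sym (trans (+-congʳ (zeroˡ _)) (-‿inverseʳ 0#))) ≤v-0#
  ≤v-[∑ᴸ]ᵖ-∑ᴸ h g (k ∷ L) ((m≤hk , hkᵖ≡gk) ∷ rest) = ≤v-cong (sym split)
    (≤v-+ (≤v-+ (≤v-[x+y]ᵖ-xᵖ-yᵖ m≤hk (≤v-∑ᴸ L (All.map proj₁ rest))) hkᵖ≡gk)
          (≤v-[∑ᴸ]ᵖ-∑ᴸ h g L rest))
    where
    H = ∑ᴸ h L
    G = ∑ᴸ g L
    split : (h k + H) ^ p - (g k + G) ≈ ((h k + H) ^ p - h k ^ p - H ^ p) + (h k ^ p - g k) + (H ^ p - G)
    split = solve 6 (λ S A B a b c → S :- (b :+ c) := (S :- A :- B) :+ (A :- b) :+ (B :- c)) refl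
      ((h k + H) ^ p) (h k ^ p) (H ^ p) (h k) (g k) G

  digit-complement : ∀ {c} → c < p → Σ ℕ λ c′ → c′ < p × (+ 1 ≤v ι c′ + ι c)
  digit-complement {zero}  _   = 0 , ℕ.s≤s ℕ.z≤n , ≤v-cong (sym (+-identityʳ 0#)) ≤v-0#
  digit-complement {suc c} c<p = p ∸ suc c , ℕ.∸-monoʳ-< (ℕ.s≤s ℕ.z≤n) (ℕ.<⇒≤ c<p) ,
    ≤v-cong (ι-+ (p ∸ suc c) (suc c))
      (≡.subst (λ k → + 1 ≤v ι k) (≡.sym (ℕ.m∸n+n≡m (ℕ.<⇒≤ c<p))) residue-char)

  ι-incongruent : ∀ {i j} → i < j → j < p → ¬ (+ 1 ≤v ι j - ι i)
  ι-incongruent {i} {j} i<j j<p 1≤ιj-ιi = v≡⇒¬+1≤v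
    (v-ι-unit (ℕ.m<n⇒0<n∸m i<j) (ℕ.≤-<-trans (ℕ.m∸n≤m j i) j<p)) (≤v-cong ιj-ιi≈ι[j∸i] 1≤ιj-ιi)
    where
    ιj-ιi≈ι[j∸i] : ι j - ι i ≈ ι (j ∸ i)
    ιj-ιi≈ι[j∸i] = begin
      ι j - ι i                   ≡⟨ ≡.cong (λ k → ι k - ι i) (ℕ.m+[n∸m]≡n (ℕ.<⇒≤ i<j)) ⟨
      ι (i ℕ.+ (j ∸ i)) - ι i     ≈⟨ +-congʳ (ι-+ i (j ∸ i)) ⟩
      (ι i + ι (j ∸ i)) - ι i     ≈⟨ solve 2 (λ a b → (a :+ b) :- a := b) refl (ι i) (ι (j ∸ i)) ⟩
      ι (j ∸ i)                   ∎

  ℘-root-mod-𝔓 : ∀ {x} → + 0 ≤v x → + 1 ≤v x ^ p - x → Σ ℕ λ c → c < p × (+ 1 ≤v x - ι c)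
  ℘-root-mod-𝔓 {x} 0≤x 1≤℘x with Fin.any? (λ (c : Fin p) → ≤v-dec (+ 1) (x - ι (toℕ c)))
  ... | yes (c , x≡c) = toℕ c , Fin.toℕ<n c , x≡c
  ... | no  x≢c = ⊥-elim (no-incongruent-roots-beyond-degree p Xᵖ-X ρ
          (≤v-0# , ≤v-neg (0≤vι 1) , Integral-monomial r)
          (≡.subst (λ l → ¬ (+ 1 ≤v l)) (≡.sym (lead-monomial r)) ¬1≤v1#)
          0≤ρ incongruent roots)
    where
    -- ι 1 rather than 1#: it is what the solver constant con (+ 1) denotes.
    Xᵖ-X : Poly p
    Xᵖ-X = 0# , - ι 1 , monomial r
    eval-Xᵖ-X : ∀ y → eval p Xᵖ-X y ≈ y ^ p - y
    eval-Xᵖ-X y = trans (+-congˡ (*-congˡ (+-congˡ (*-congˡ (eval-monomial r y)))))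
      (solve 2 (λ y Y → con (+ 0) :+ y :* (:- con (+ 1) :+ y :* Y) := y :* (y :* Y) :- y) refl y (y ^ r))
    ρ : ℕ → Carrier
    ρ zero    = x
    ρ (suc i) = ι i
    0≤ρ : ∀ i → i ≤ p → + 0 ≤v ρ i
    0≤ρ zero    _ = 0≤x
    0≤ρ (suc i) _ = 0≤vι i
    incongruent : ∀ i j → i < j → j ≤ p → ¬ (+ 1 ≤v ρ j - ρ i)
    incongruent zero    (suc j) _           j<p 1≤ιj-x = x≢c (Fin.fromℕ< j<p ,
      ≡.subst (λ k → + 1 ≤v x - ι k) (≡.sym (Fin.toℕ-fromℕ< j<p))
        (≤v-cong (-[x-y]≈y-x (ι j) x) (≤v-neg 1≤ιj-x)))
    incongruent (suc i) (suc j) (ℕ.s≤s i<j) j<p = ι-incongruent i<j j<p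
    roots : ∀ i → i ≤ p → + 1 ≤v eval p Xᵖ-X (ρ i)
    roots zero    _ = ≤v-cong (sym (eval-Xᵖ-X x)) 1≤℘x
    roots (suc i) _ = ≤v-cong (sym (eval-Xᵖ-X (ι i))) (≤v-ιᵖ-ι i)

module Induction {r c ℓ} (pp : Prime (suc (suc r))) (K : CDVF (suc (suc r)) c ℓ) where
  open CDVF K
  open ResidueField pp K
  open RingOpsProperties p cring
  open Valuation K

  module Rows
    (n : ℕ) (ω : ℕ → Carrier) (e : ℕ → ℤ)
    (ω₁≈1 : ω 1 ≈ 1#)
    (v-ω : ∀ i → 1 ≤ i → i ≤ n → v (ω i) ≡ fin (e i))
    (e₁≡0 : e 1 ≡ + 0)
    (e-step : ∀ i → 1 ≤ i → i < n → e (suc i) ≤ℤ e i)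
    (ω-independent : ∀ i j → 1 ≤ i → i < j → j ≤ n → (∀ k → i ≤ k → k ≤ j → e k ≡ e i) →
      (a : ℕ → ℕ) → (∀ k → a k < p) →
      fin (e i +ℤ + 1) ≤∞ v (∑ᴷ[ i , j ] (λ k → ι (a k) * ω k)) →
      ∀ k → i ≤ k → k ≤ j → a k ≡ 0)
    where

    Ω[_,_] : ℕ → ℕ → Carrier
    Ω[ i , j ] = Ω K ω i j

    ν : ℕ → ℕ → ℤ
    ν i j = + (p ^ℕ (i ∸ 1)) *ℤ (e j -ℤ e i)

    combination : ℕ → (ℕ → ℕ) → ℕ → ℕ → Carrier
    combination i a s t = ∑ᴷ[ s , t ] (λ k → ι (a k) * Ω[ i , k ])

    Flat : ℕ → ℕ → Set
    Flat s t = ∀ k → s ≤ k → k ≤ t → e k ≡ e s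

    Digits : (ℕ → ℕ) → Set
    Digits a = ∀ k → a k < p

    combination-prepend : ∀ {i s t c a} → i < s → s ≤ t →
      combination i (prepend i c a s) i t ≈ ι c * Ω[ i , i ] + combination i a s t
    combination-prepend {i} {s} {t} {c} {a} i<s s≤t = begin
      combination i a′ i t
        ≡⟨ ∑ᴷ-cons _ (ℕ.<⇒≤ (ℕ.<-≤-trans i<s s≤t)) ⟩
      ι (a′ i) * Ω[ i , i ] + combination i a′ (suc i) t
        ≡⟨ ≡.cong (λ x → ι x * Ω[ i , i ] + combination i a′ (suc i) t) (prepend-head {i} {c} {a} {s} i<s) ⟩
      ι c * Ω[ i , i ] + combination i a′ (suc i) t
        ≈⟨ +-congˡ (∑ᴷ-drop-zeros _ i<s (ℕ.m≤n⇒m≤1+n s≤t) gap) ⟩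
      ι c * Ω[ i , i ] + combination i a′ s t
        ≈⟨ +-congˡ (∑ᴷ-cong {s} {t} block) ⟩
      ι c * Ω[ i , i ] + combination i a s t
        ∎
      where
      open import Relation.Binary.Reasoning.Setoid setoid
      a′ = prepend i c a s
      block : ∀ k → s ≤ k → k ≤ t → ι (a′ k) * Ω[ i , k ] ≈ ι (a k) * Ω[ i , k ]
      block k s≤k _ = reflexive (≡.cong (λ x → ι x * Ω[ i , k ]) (prepend-block {i} {c} {a} k s≤k))
      gap : ∀ k → suc i ≤ k → k < s → ι (a′ k) * Ω[ i , k ] ≈ 0#
      gap k i<k k<s = trans (reflexive (≡.cong (λ x → ι x * Ω[ i , k ]) (prepend-gap {i} {c} {a} i<k k<s))) (zeroˡ _)

    record Row (i : ℕ) : Set ℓ where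
      field
        v-Ω         : ∀ j → i ≤ j → j ≤ n → v Ω[ i , j ] ≡ fin (ν i j)
        Ω-diagonal  : Ω[ i , i ] ≈ 1#
        independent : ∀ s t → i ≤ s → s < t → t ≤ n → Flat s t → ∀ a → Digits a →
          (ν i s +ℤ + 1) ≤v combination i a s t → ∀ k → s ≤ k → k ≤ t → a k ≡ 0

    e-antitone : ∀ {a b} → 1 ≤ a → a ≤ b → b ≤ n → e b ≤ℤ e a
    e-antitone 1≤a a≤b = go (ℕ.≤⇒≤′ a≤b)
      where
      go : ∀ {b} → _ ℕ.≤′ b → b ≤ n → e b ≤ℤ e _
      go ℕ.≤′-refl          _     = ℤ.≤-refl
      go (ℕ.≤′-step a≤′b) 1+b≤n =
        ℤ.≤-trans (e-step _ (ℕ.≤-trans 1≤a (ℕ.≤′⇒≤ a≤′b)) 1+b≤n) (go a≤′b (ℕ.<⇒≤ 1+b≤n))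

    e-squeeze : ∀ {i j k} → 1 ≤ i → i ≤ k → k ≤ j → j ≤ n → e j ≡ e i → e k ≡ e i
    e-squeeze 1≤i i≤k k≤j j≤n ej≡ei = ℤ.≤-antisym (e-antitone 1≤i i≤k (ℕ.≤-trans k≤j j≤n))
      (≡.subst (_≤ℤ e _) ej≡ei (e-antitone (ℕ.≤-trans 1≤i i≤k) k≤j j≤n))

    ν-flat : ∀ {i j} → e j ≡ e i → ν i j ≡ + 0
    ν-flat {i} ej≡ei = ≡.trans (≡.cong (λ x → + (p ^ℕ (i ∸ 1)) *ℤ (x -ℤ e i)) ej≡ei)
      (≡.trans (≡.cong (+ (p ^ℕ (i ∸ 1)) *ℤ_) (ℤ.+-inverseʳ (e i))) (ℤ.*-zeroʳ (+ (p ^ℕ (i ∸ 1)))))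

    ν-negative : ∀ {i j} → e j <ℤ e i → ν i j <ℤ + 0
    ν-negative {i} {j} ej<ei = ≡.subst (ν i j <ℤ_) (ℤ.*-zeroʳ (+ P))
      (ℤ.*-monoˡ-<-pos (+ P) {{ℤ.positive (ℤ.+<+ (ℕ.m^n>0 p (i ∸ 1)))}}
        (≡.subst (e j -ℤ e i <ℤ_) (ℤ.+-inverseʳ (e i)) (ℤ.+-monoˡ-< (-ℤ e i) ej<ei)))
      where P = p ^ℕ (i ∸ 1)

    ν-step : ∀ i j → + p *ℤ ν (suc i) j -ℤ + p *ℤ ν (suc i) (suc (suc i)) ≡ ν (suc (suc i)) j
    ν-step i j = ≡.trans (distribute (+ p) (+ (p ^ℕ i)) (e j) (e (suc (suc i))) (e (suc i)))
      (≡.cong (_*ℤ (e j -ℤ e (suc (suc i)))) (≡.sym (ℤ.pos-* p (p ^ℕ i))))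
      where
      distribute : ∀ P Q a b c → P *ℤ (Q *ℤ (a -ℤ c)) -ℤ P *ℤ (Q *ℤ (b -ℤ c)) ≡ (P *ℤ Q) *ℤ (a -ℤ b)
      distribute = ℤ-Solver.solve-∀

    row-one : Row 1
    row-one = record
      { v-Ω         = λ j 1≤j j≤n → ≡.trans (v-ω j 1≤j j≤n) (≡.cong fin (≡.sym (ν₁ j)))
      ; Ω-diagonal  = ω₁≈1
      ; independent = λ s t 1≤s s<t t≤n flat a digits →
          ω-independent s t 1≤s s<t t≤n flat a digits
          ∘ ≡.subst (λ N → (N +ℤ + 1) ≤v combination 1 a s t) (ν₁ s)
      }
      where
      ν₁ : ∀ j → ν 1 j ≡ e j
      ν₁ j = ≡.trans (ℤ.*-identityˡ (e j -ℤ e 1))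
        (≡.trans (≡.cong (λ x → e j -ℤ x) e₁≡0) (ℤ.+-identityʳ (e j)))

    module RowProperties {i} (1≤i : 1 ≤ i) (row : Row i) where
      open Row row
      open import Relation.Binary.Reasoning.Setoid setoid

      -- Absorb -c into the combination as the digit c′ ≡ -c at Ω_{i,i} = 1, then use independence on [i, t].
      no-constant-combination : ∀ s t → i < s → s ≤ t → t ≤ n → Flat i t → ∀ a → Digits a → ∀ c → c < p →
        + 1 ≤v combination i a s t - ι c → ∀ k → s ≤ k → k ≤ t → a k ≡ 0
      no-constant-combination s t i<s s≤t t≤n flat a digits c c<p Y≡c k s≤k k≤t =
        ≡.trans (≡.sym (prepend-block {i} {c′} {a} k s≤k))
          (independent i t ℕ.≤-refl (ℕ.<-≤-trans i<s s≤t) t≤n flat a′ a′-digits 1≤combination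
             k (ℕ.<⇒≤ (ℕ.<-≤-trans i<s s≤k)) k≤t)
        where
        complement = digit-complement c<p
        c′ = proj₁ complement
        a′ = prepend i c′ a s
        a′-digits = prepend-digits {i} {c′} {a} {s} (proj₁ (proj₂ complement)) digits
        Y = combination i a s t
        1≤combination : (ν i i +ℤ + 1) ≤v combination i a′ i t
        1≤combination = ≡.subst (λ N → (N +ℤ + 1) ≤v combination i a′ i t) (≡.sym (ν-flat {i} ≡.refl))
          (≤v-cong (sym (begin
            combination i a′ i t              ≈⟨ combination-prepend i<s s≤t ⟩
            ι c′ * Ω[ i , i ] + Y             ≈⟨ +-congʳ (trans (*-congˡ Ω-diagonal) (*-identityʳ _)) ⟩
            ι c′ + Y                          ≈⟨ solve 3 (λ x y z → x :+ y := (x :+ z) :+ (y :- z)) refl (ι c′) Y (ι c) ⟩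
            (ι c′ + ι c) + (Y - ι c)          ∎))
            (≤v-+ (proj₂ (proj₂ complement)) Y≡c))

      v-℘Ω : ∀ j → i < j → j ≤ n → v (℘ Ω[ i , j ]) ≡ fin (+ p *ℤ ν i j)
      v-℘Ω j i<j j≤n with e j ℤ.≟ e i
      ... | yes ej≡ei = ≡.trans (v-exact 0≤℘Ω 1≰℘Ω)
        (≡.cong fin (≡.sym (≡.trans (≡.cong (+ p *ℤ_) νij≡0) (ℤ.*-zeroʳ (+ p)))))
        where
        νij≡0 = ν-flat ej≡ei
        0≤Ω : + 0 ≤v Ω[ i , j ]
        0≤Ω = v≡⇒≤v (≡.trans (v-Ω j (ℕ.<⇒≤ i<j) j≤n) (≡.cong fin νij≡0))
        0≤℘Ω : + 0 ≤v ℘ Ω[ i , j ]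
        0≤℘Ω = ≤v-- (≡.subst (_≤v Ω[ i , j ] ^ p) (ℤ.*-zeroʳ (+ p)) (≤v-^ p 0≤Ω)) 0≤Ω
        one-term : combination i (λ _ → 1) j j ≈ Ω[ i , j ]
        one-term = trans (∑ᴷ-singleton _ j) (trans (*-congʳ (+-identityʳ 1#)) (*-identityˡ _))
        1≰℘Ω : ¬ ((+ 0 +ℤ + 1) ≤v ℘ Ω[ i , j ])
        1≰℘Ω 1≤℘Ω with ℘-root-mod-𝔓 0≤Ω 1≤℘Ω
        ... | c , c<p , Ω≡c with no-constant-combination j j i<j ℕ.≤-refl j≤n
                                   (λ k i≤k k≤j → e-squeeze 1≤i i≤k k≤j j≤n ej≡ei)
                                   (λ _ → 1) (λ _ → ℕ.s≤s (ℕ.s≤s ℕ.z≤n)) c c<p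
                                   (≤v-cong (+-congʳ (sym one-term)) Ω≡c) j ℕ.≤-refl ℕ.≤-refl
        ...   | ()
      ... | no ej≢ei = v-+-dominant (v-^ p vΩ) (≤v-neg (≤v-weaken (i<0⇒[2+k]*i+1≤i r νij<0) (v≡⇒≤v vΩ)))
        where
        vΩ = v-Ω j (ℕ.<⇒≤ i<j) j≤n
        νij<0 = ν-negative (ℤ.≤∧≢⇒< (e-antitone 1≤i (ℕ.<⇒≤ i<j) j≤n) ej≢ei)

    module Step {i} (row : Row (suc i)) (i+2≤n : suc (suc i) ≤ n) where
      I = suc i
      open Row row
      open RowProperties (ℕ.s≤s ℕ.z≤n) row
      open import Relation.Binary.Reasoning.Setoid setoid
      open import Algebra.Properties.Ring ring using (x[y-z]≈xy-xz)

      D : Carrier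
      D = ℘ Ω[ I , suc I ]

      vD : v D ≡ fin (+ p *ℤ ν I (suc I))
      vD = v-℘Ω (suc I) ℕ.≤-refl i+2≤n

      D≉0 : ¬ (D ≈ 0#)
      D≉0 D≈0 with () ← ≡.trans (≡.sym vD) (≡.trans (v-cong D≈0) v-0)

      v-Ω-next : ∀ j → suc I ≤ j → j ≤ n → v Ω[ suc I , j ] ≡ fin (ν (suc I) j)
      v-Ω-next j I<j j≤n = ≡.trans (v-/ D≉0 (v-℘Ω j I<j j≤n) vD) (≡.cong fin (ν-step i j))

      ν≤Ω : ∀ {s t k} → suc I ≤ s → t ≤ n → Flat s t → s ≤ k → k ≤ t → ν I s ≤v Ω[ I , k ]
      ν≤Ω {s} {t} {k} I<s t≤n flat s≤k k≤t =
        v≡⇒≤v (≡.trans (v-Ω k (ℕ.≤-trans (ℕ.n≤1+n I) (ℕ.≤-trans I<s s≤k)) (ℕ.≤-trans k≤t t≤n))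
          (≡.cong (λ x → fin (+ (p ^ℕ i) *ℤ (x -ℤ e I))) (flat k s≤k k≤t)))

      ν≤aΩ : ∀ {s t k} (a : ℕ → ℕ) → suc I ≤ s → t ≤ n → Flat s t → s ≤ k → k ≤ t →
        ν I s ≤v ι (a k) * Ω[ I , k ]
      ν≤aΩ {s} {k = k} a I<s t≤n flat s≤k k≤t = ≡.subst (_≤v ι (a k) * Ω[ I , k ]) (ℤ.+-identityˡ (ν I s))
        (≤v-* (0≤vι (a k)) (ν≤Ω I<s t≤n flat s≤k k≤t))

      ν≤combination : ∀ {s t} (a : ℕ → ℕ) → suc I ≤ s → t ≤ n → Flat s t → ν I s ≤v combination I a s t
      ν≤combination a I<s t≤n flat = ≤v-∑ᴷ (λ k → ν≤aΩ a I<s t≤n flat)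

      -- Y^p - Y = (Y^p - Σ a_k Ω_{I,k}^p) + Σ a_k ℘(Ω_{I,k}): the first term is small by Frobenius and
      -- Fermat, the second is D times the combination in row I + 1.
      ℘-combination : ∀ s t → suc I ≤ s → t ≤ n → Flat s t → ∀ a →
        (ν (suc I) s +ℤ + 1) ≤v combination (suc I) a s t →
        (+ p *ℤ ν I s +ℤ + 1) ≤v combination I a s t ^ p - combination I a s t
      ℘-combination s t I<s t≤n flat a 1≤next =
        ≤v-cong (sym Yᵖ-Y≈) (≤v-+ (≤v-[∑ᴸ]ᵖ-∑ᴸ _ _ (rangeℕ s t) (All-rangeℕ s t termwise)) 1≤S)
        where
        Y  = combination I a s t
        S  = ∑ᴷ[ s , t ] (λ k → ι (a k) * ℘ Ω[ I , k ])
        Gᵖ = ∑ᴷ[ s , t ] (λ k → ι (a k) * Ω[ I , k ] ^ p)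
        next≈S/D : combination (suc I) a s t ≈ S / D
        next≈S/D = trans (∑ᴸ-cong (rangeℕ s t) (λ k → sym (*-assoc _ _ _))) (∑ᴸ-*ʳ _ (D ⁻¹) (rangeℕ s t))
        S≈Gᵖ-Y : S ≈ Gᵖ - Y
        S≈Gᵖ-Y = trans (∑ᴸ-cong (rangeℕ s t) λ k → x[y-z]≈xy-xz (ι (a k)) (Ω[ I , k ] ^ p) Ω[ I , k ])
                       (∑ᴸ-- _ _ (rangeℕ s t))
        1≤S : (+ p *ℤ ν I s +ℤ + 1) ≤v S
        1≤S = ≡.subst (λ N → N ≤v S)
          (≡.trans (≡.cong (λ x → x +ℤ + 1 +ℤ + p *ℤ ν I (suc I)) (≡.sym (ν-step i s)))
                   ([x-y]+1+y≡x+1 (+ p *ℤ ν I s) (+ p *ℤ ν I (suc I))))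
          (≤v-cong (/*≈ D≉0 S) (≤v-* (≤v-cong next≈S/D 1≤next) (v≡⇒≤v vD)))
        Yᵖ-Y≈ : Y ^ p - Y ≈ (Y ^ p - Gᵖ) + S
        Yᵖ-Y≈ = trans (solve 3 (λ A B C → A :- C := (A :- B) :+ (B :- C)) refl (Y ^ p) Gᵖ Y) (+-congˡ (sym S≈Gᵖ-Y))
        termwise : ∀ k → s ≤ k → k ≤ t →
          (ν I s ≤v ι (a k) * Ω[ I , k ]) ×
          ((+ p *ℤ ν I s +ℤ + 1) ≤v (ι (a k) * Ω[ I , k ]) ^ p - ι (a k) * Ω[ I , k ] ^ p)
        termwise k s≤k k≤t = ν≤aΩ a I<s t≤n flat s≤k k≤t ,
          ≤v-cong (sym factor) (≡.subst (λ N → N ≤v (ι (a k) ^ p - ι (a k)) * Ω[ I , k ] ^ p)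
                                        (ℤ.+-comm (+ 1) (+ p *ℤ ν I s))
            (≤v-* (≤v-ιᵖ-ι (a k)) (≤v-^ p (ν≤Ω I<s t≤n flat s≤k k≤t))))
          where
          factor : (ι (a k) * Ω[ I , k ]) ^ p - ι (a k) * Ω[ I , k ] ^ p ≈ (ι (a k) ^ p - ι (a k)) * Ω[ I , k ] ^ p
          factor = trans (+-congʳ (^-distrib-* (ι (a k)) Ω[ I , k ] p))
            (solve 3 (λ A B X → A :* X :- B :* X := (A :- B) :* X) refl (ι (a k) ^ p) (ι (a k)) (Ω[ I , k ] ^ p))

      independent-next : ∀ s t → suc I ≤ s → s < t → t ≤ n → Flat s t → ∀ a → Digits a →
        (ν (suc I) s +ℤ + 1) ≤v combination (suc I) a s t → ∀ k → s ≤ k → k ≤ t → a k ≡ 0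
      independent-next s t I<s s<t t≤n flat a digits 1≤next with e s ℤ.≟ e I
      ... | yes es≡eI = no-constant-combination s t I<s (ℕ.<⇒≤ s<t) t≤n flat-from-I a digits d d<p Y≡d
        where
        νIs≡0 : ν I s ≡ + 0
        νIs≡0 = ν-flat es≡eI
        0≤Y : + 0 ≤v combination I a s t
        0≤Y = ≡.subst (_≤v combination I a s t) νIs≡0 (ν≤combination a I<s t≤n flat)
        1≤℘Y : + 1 ≤v combination I a s t ^ p - combination I a s t
        1≤℘Y = ≡.subst (λ N → N ≤v combination I a s t ^ p - combination I a s t)
          (≡.trans (≡.cong (λ x → + p *ℤ x +ℤ + 1) νIs≡0) (≡.cong (_+ℤ + 1) (ℤ.*-zeroʳ (+ p))))
          (℘-combination s t I<s t≤n flat a 1≤next)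
        root = ℘-root-mod-𝔓 0≤Y 1≤℘Y
        d = proj₁ root
        d<p = proj₁ (proj₂ root)
        Y≡d = proj₂ (proj₂ root)
        flat-from-I : Flat I t
        flat-from-I k I≤k k≤t with k ℕ.≤? s
        ... | yes k≤s = e-squeeze (ℕ.s≤s ℕ.z≤n) I≤k k≤s (ℕ.≤-trans (ℕ.<⇒≤ s<t) t≤n) es≡eI
        ... | no  k≰s = ≡.trans (flat k (ℕ.<⇒≤ (ℕ.≰⇒> k≰s)) k≤t) es≡eI
      ... | no es≢eI = independent s t (ℕ.<⇒≤ I<s) s<t t≤n flat a digits (<v-^-cancel {ν I s} p Yᵖ-bound)
        where
        Y = combination I a s t
        νIs<0 : ν I s <ℤ + 0
        νIs<0 = ν-negative
          (ℤ.≤∧≢⇒< (e-antitone (ℕ.s≤s ℕ.z≤n) (ℕ.<⇒≤ I<s) (ℕ.≤-trans (ℕ.<⇒≤ s<t) t≤n)) es≢eI)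
        Yᵖ-bound : (+ p *ℤ ν I s +ℤ + 1) ≤v Y ^ p
        Yᵖ-bound = ≤v-cong (solve 2 (λ A Y → (A :- Y) :+ Y := A) refl (Y ^ p) Y)
          (≤v-+ (℘-combination s t I<s t≤n flat a 1≤next)
                (≤v-weaken (i<0⇒[2+k]*i+1≤i r νIs<0) (ν≤combination a I<s t≤n flat)))

      row-next : Row (suc I)
      row-next = record
        { v-Ω         = v-Ω-next
        ; Ω-diagonal  = inverseʳ D D≉0
        ; independent = independent-next
        }

    ν-telescope : ∀ {i j} → i ≤ j → ν i j ≡ -ℤ (+ (p ^ℕ (i ∸ 1)) *ℤ ∑[ suc i , j ] (λ k → e (k ∸ 1) -ℤ e k))
    ν-telescope {i} {j} i≤j = ≡.trans (flip (+ (p ^ℕ (i ∸ 1))) (e j) (e i))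
      (≡.cong (λ x → -ℤ (+ (p ^ℕ (i ∸ 1)) *ℤ x)) (≡.sym (∑-telescope e i≤j)))
      where
      flip : ∀ P a b → P *ℤ (a -ℤ b) ≡ -ℤ (P *ℤ (b -ℤ a))
      flip = ℤ-Solver.solve-∀

    row : ∀ i → 1 ≤ i → i ≤ n → Row i
    row (suc zero)    _ _      = row-one
    row (suc (suc i)) _ i+2≤n = Step.row-next (row (suc i) (ℕ.s≤s ℕ.z≤n) (ℕ.<⇒≤ i+2≤n)) i+2≤n

    ℘Ω≉0 : ∀ i → 2 ≤ i → i ≤ n → ¬ (℘ (Ω K ω (i ∸ 1) i) ≈ 0#)
    ℘Ω≉0 (suc zero)    (ℕ.s≤s ()) _
    ℘Ω≉0 (suc (suc i)) _ i+2≤n = Step.D≉0 (row (suc i) (ℕ.s≤s ℕ.z≤n) (ℕ.<⇒≤ i+2≤n)) i+2≤n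

    v-Ωᵢⱼ : ∀ i j → 1 ≤ i → i ≤ j → j ≤ n → v (Ω K ω i j) ≡ fin (ν i j)
    v-Ωᵢⱼ i j 1≤i i≤j j≤n = Row.v-Ω (row i 1≤i (ℕ.≤-trans i≤j j≤n)) j i≤j j≤n

lemma3p4 : ∀ {c ℓ} (p n : ℕ) → Prime p → (K : CDVF p c ℓ) →
    let open CDVF K in
    1 < n →
    -- the elements ω_1, …, ω_n of K_0 and their (finite) valuations e_i = v_0(ω_i)
    (ω : ℕ → Carrier) (e : ℕ → ℤ) →
    ω 1 ≈ 1# →
    (∀ i → 1 ≤ i → i ≤ n → v (ω i) ≡ fin (e i)) →
    e 1 ≡ + 0 →
    (∀ i → 1 ≤ i → i < n → e (suc i) ≤ℤ e i) →
    -- if v(ω_i) = … = v(ω_j), i < j, the images of ω_i, …, ω_j in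
    -- ω_i 𝔒_0 / ω_i 𝔓_0 are 𝔽_p-linearly independent
    (∀ i j → 1 ≤ i → i < j → j ≤ n →
      (∀ k → i ≤ k → k ≤ j → e k ≡ e i) →
      (a : ℕ → ℕ) → (∀ k → a k < p) →
      fin (e i +ℤ + 1) ≤∞ v (∑ᴷ[ i , j ] (λ k → ι (a k) * ω k)) →
      ∀ k → i ≤ k → k ≤ j → a k ≡ 0) →
    -- ramification data: b_1 and upper ramification numbers u_1, …, u_n,
    -- with m_k = v_0(ω_{k-1}) - v_0(ω_k) and u_i = b_1 + p^{n-1} ∑_{k=2}^i m_k
    (b₁ : ℤ) (u : ℕ → ℤ) →
    + 0 <ℤ b₁ →
    ¬ (+ p ∣ℤ u 1) →
    (∀ i → 1 ≤ i → i ≤ n →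
      u i ≡ b₁ +ℤ (+ (p ^ℕ (n ∸ 1))) *ℤ (∑[ 2 , i ] (λ k → e (k ∸ 1) -ℤ e k))) →
    -- conclusion
    (∀ i → 2 ≤ i → i ≤ n → ¬ (℘ (Ω K ω (i ∸ 1) i) ≈ 0#))
    ×
    (∀ i j → 1 ≤ i → i ≤ j → j ≤ n →
      (v (Ω K ω i j) ≡
         fin (-ℤ ((+ (p ^ℕ (i ∸ 1))) *ℤ (∑[ suc i , j ] (λ k → e (k ∸ 1) -ℤ e k)))))
      ×
      -- p^{i-n}(u_i - u_j) equals the same value (cleared of the factor p^{i-n})
      ((+ (p ^ℕ (n ∸ i))) *ℤ
         (-ℤ ((+ (p ^ℕ (i ∸ 1))) *ℤ (∑[ suc i , j ] (λ k → e (k ∸ 1) -ℤ e k))))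
        ≡ u i -ℤ u j))
lemma3p4 zero          _ pp = ⊥-elim (ℕ.n≮0 (prime>1 pp))
lemma3p4 (suc zero)    _ pp = ⊥-elim (ℕ.<-irrefl ≡.refl (prime>1 pp))
lemma3p4 (suc (suc r)) n pp K _ ω e ω₁≈1 v-ω e₁≡0 e-step ω-independent b₁ u _ _ u≡ =
  ℘Ω≉0 , λ i j 1≤i i≤j j≤n →
    ≡.trans (v-Ωᵢⱼ i j 1≤i i≤j j≤n) (≡.cong fin (ν-telescope i≤j)) ,
    upper-ramification-difference e (suc (suc r)) n b₁ u 1≤i i≤j j≤n u≡
  where open Induction.Rows pp K n ω e ω₁≈1 v-ω e₁≡0 e-step ω-independent
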